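{- For every integer $k\geq 1$ there is a well-defined $\mathbb{Q}$-linear map $\pi_k:\mathcal{E}_k\to\mathcal{D}_k$ which on the generators $G$ is given by \[ \pi_k\Big(G\begin{bmatrix}k'\\ d\end{bmatrix}\Big)=\delta_{d,0}\,Z_{k'}+\delta_{k',1}\,d!\,Z_{d+1}\qquad(k'+d=k), \] \[ \pi_k\Big(G\begin{bmatrix}k_1,k_2\\ d_1,d_2\end{bmatrix}\Big)=\delta_{(d_1,d_2),(0,0)}\,Z_{k_1,k_2}+\delta_{(k_1,k_2),(1,1)}\sum_{\substack{a+b=d_1+d_2+2\\ a,b\geq 1}}\frac{d_1!\,(a-1)!}{(a-1-d_2)!}\,Z_{a,b}\qquad(k_1+k_2+d_1+d_2=k), \] i.e. these assignments (together with the images of the $P$-symbols they force via the defining relations) respect all defining relations of $\mathcal{E}_k$ and $\mathcal{D}_k$.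
   Context: Formal double zeta space: for $k\geq1$, $\mathcal{D}_k$ is the $\mathbb{Q}$-vector space spanned by formal symbols $Z_k$, $Z_{k_1,k_2}$, $P_{k_1,k_2}$ ($k_1,k_2\geq1$, $k_1+k_2=k$) modulo the relations, for all such $k_1,k_2$: $P_{k_1,k_2}=Z_{k_1,k_2}+Z_{k_2,k_1}+Z_{k_1+k_2}=\sum_{j=1}^{k_1+k_2-1}\left(\binom{j-1}{k_1-1}+\binom{j-1}{k_2-1}\right)Z_{j,k_1+k_2-j}$. Formal double Eisenstein space: for $K\geq1$, $\mathcal{E}_K$ is the $\mathbb{Q}$-vector space spanned by formal symbols $G\begin{bmatrix}k\\ d\end{bmatrix}$ ($k\geq1,d\geq0$, $k+d=K$) and $G\begin{bmatrix}k_1,k_2\\ d_1,d_2\end{bmatrix}$, $P\begin{bmatrix}k_1,k_2\\ d_1,d_2\end{bmatrix}$ ($k_1,k_2\geq1$, $d_1,d_2\geq0$, $k_1+k_2+d_1+d_2=K$), modulo the relations, for all such $k_1,k_2,d_1,d_2$: $P\begin{bmatrix}k_1,k_2\\ d_1,d_2\end{bmatrix}=G\begin{bmatrix}k_1,k_2\\ d_1,d_2\end{bmatrix}+G\begin{bmatrix}k_2,k_1\\ d_2,d_1\end{bmatrix}+G\begin{bmatrix}k_1+k_2\\ d_1+d_2\end{bmatrix}$ $=\sum_{\substack{l_1+l_2=k_1+k_2,\ e_1+e_2=d_1+d_2\\ l_1,l_2\geq1,\ e_1,e_2\geq0}}\left(\binom{l_1-1}{k_1-1}\binom{d_1}{e_1}(-1)^{d_1-e_1}+\binom{l_1-1}{k_2-1}\binom{d_2}{e_1}(-1)^{d_2-e_1}\right)G\begin{bmatrix}l_1,l_2\\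 e_1,e_2\end{bmatrix}+\frac{d_1!\,d_2!}{(d_1+d_2+1)!}\binom{k_1+k_2-2}{k_1-1}G\begin{bmatrix}k_1+k_2-1\\ d_1+d_2+1\end{bmatrix}$. $\delta$ denotes the Kronecker delta. In the sum, terms with $a-1<d_2$ are zero (convention $1/n!=0$ for $n<0$). -}

module Defs where

open import Data.Nat as ℕ using (ℕ; zero; suc; _∸_; _≡ᵇ_; _<ᵇ_; _!; _≤_)
open import Data.Nat.Properties using (_!≢0)
open import Data.Nat.Combinatorics using (_C_)
open import Data.Integer as ℤ using (+_)
open import Data.Rational as ℚ using (ℚ; 0ℚ; 1ℚ; _+_; _*_; -_; _/_)
open import Data.Bool using (Bool; true; false; if_then_else_; _∧_)
open import Data.List using (List; []; _∷_; _++_; map; concatMap; upTo; foldr)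
open import Data.Product using (_×_; _,_; ∃)
open import Relation.Binary.PropositionalEquality using (_≡_)

-- [ a .. b ] (inclusive; empty if b < a)
range : ℕ → ℕ → List ℕ
range a b = map (λ i → a ℕ.+ i) (upTo (suc b ∸ a))

δ : ℕ → ℕ → ℚ
δ m n = if m ≡ᵇ n then 1ℚ else 0ℚ

ℕ→ℚ : ℕ → ℚ
ℕ→ℚ n = (+ n) / 1

sgn : ℕ → ℚ
sgn zero = 1ℚ
sgn (suc n) = - sgn n

data ZSym : Set where
  Z₁ : ℕ → ZSym
  Z₂ : ℕ → ℕ → ZSym

-- G[k;d] and G[k₁,k₂;d₁,d₂] of the double Eisenstein space
data GSym : Set where
  G₁ : ℕ → ℕ → GSym
  G₂ : ℕ → ℕ → ℕ → ℕ → GSym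

eqZ : ZSym → ZSym → Bool
eqZ (Z₁ k) (Z₁ k') = k ≡ᵇ k'
eqZ (Z₂ a b) (Z₂ a' b') = (a ≡ᵇ a') ∧ (b ≡ᵇ b')
eqZ _ _ = false

-- Formal ℚ-linear combinations (elements of the free ℚ-vector space)
Lin : Set → Set
Lin S = List (ℚ × S)

scale : {S : Set} → ℚ → Lin S → Lin S
scale c = map (λ { (x , s) → (c * x , s) })

sumL : {S A : Set} → List A → (A → Lin S) → Lin S
sumL is f = concatMap f is

coeffZ : Lin ZSym → ZSym → ℚ
coeffZ v s = foldr (λ { (c , t) acc → (if eqZ t s then c else 0ℚ) + acc }) 0ℚ v

-- Defining relations of 𝒟_k (P eliminated):
--   Z_{k₁,k₂} + Z_{k₂,k₁} + Z_{k₁+k₂}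
--     - Σ_{j=1}^{k₁+k₂-1} (C(j-1,k₁-1)+C(j-1,k₂-1)) Z_{j,k₁+k₂-j}
relD : ℕ → ℕ → Lin ZSym
relD k₁ k₂ =
  (1ℚ , Z₂ k₁ k₂) ∷ (1ℚ , Z₂ k₂ k₁) ∷ (1ℚ , Z₁ k) ∷
  sumL (range 1 (k ∸ 1)) (λ j →
    (- ℕ→ℚ (((j ∸ 1) C (k₁ ∸ 1)) ℕ.+ ((j ∸ 1) C (k₂ ∸ 1))) , Z₂ j (k ∸ j)) ∷ [])
  where k = k₁ ℕ.+ k₂

-- Defining relations of ℰ_K (P eliminated):
--   G[k₁,k₂;d₁,d₂] + G[k₂,k₁;d₂,d₁] + G[k₁+k₂;d₁+d₂]
--   - Σ_{l₁+l₂=k₁+k₂, e₁+e₂=d₁+d₂} ( C(l₁-1,k₁-1) C(d₁,e₁) (-1)^{d₁-e₁}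
--                                   + C(l₁-1,k₂-1) C(d₂,e₁) (-1)^{d₂-e₁} ) G[l₁,l₂;e₁,e₂]
--   - d₁! d₂! / (d₁+d₂+1)! · C(k₁+k₂-2,k₁-1) · G[k₁+k₂-1; d₁+d₂+1]
-- (when e₁ > dᵢ the binomial C(dᵢ,e₁) vanishes, so the truncated
--  exponent dᵢ ∸ e₁ is irrelevant there)
relE : ℕ → ℕ → ℕ → ℕ → Lin GSym
relE k₁ k₂ d₁ d₂ =
  (1ℚ , G₂ k₁ k₂ d₁ d₂) ∷ (1ℚ , G₂ k₂ k₁ d₂ d₁) ∷ (1ℚ , G₁ k d) ∷
  (sumL (range 1 (k ∸ 1)) (λ l₁ → sumL (range 0 d) (λ e₁ →
    (- ( ℕ→ℚ (((l₁ ∸ 1) C (k₁ ∸ 1)) ℕ.* (d₁ C e₁)) * sgn (d₁ ∸ e₁)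
       + ℕ→ℚ (((l₁ ∸ 1) C (k₂ ∸ 1)) ℕ.* (d₂ C e₁)) * sgn (d₂ ∸ e₁))
    , G₂ l₁ (k ∸ l₁) e₁ (d ∸ e₁)) ∷ []))
  ++ ((- (((+ (d₁ ! ℕ.* d₂ !)) / (suc d !)) {{suc d !≢0}}
          * ℕ→ℚ ((k ∸ 2) C (k₁ ∸ 1)))
       , G₁ (k ∸ 1) (suc d)) ∷ []))
  where k = k₁ ℕ.+ k₂
        d = d₁ ℕ.+ d₂

πcoef : ℕ → ℕ → ℕ → ℚ
πcoef d₁ d₂ a =
  if (a ∸ 1) <ᵇ d₂ then 0ℚ
  else ((+ (d₁ ! ℕ.* (a ∸ 1) !)) / ((a ∸ 1 ∸ d₂) !)) {{(a ∸ 1 ∸ d₂) !≢0}}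

πG : GSym → Lin ZSym
πG (G₁ k' d) = (δ d 0 , Z₁ k') ∷ (δ k' 1 * ℕ→ℚ (d !) , Z₁ (suc d)) ∷ []
πG (G₂ k₁ k₂ d₁ d₂) =
  (δ d₁ 0 * δ d₂ 0 , Z₂ k₁ k₂) ∷
  scale (δ k₁ 1 * δ k₂ 1)
    (sumL (range 1 (suc (d₁ ℕ.+ d₂))) (λ a →
      (πcoef d₁ d₂ a , Z₂ a (d₁ ℕ.+ d₂ ℕ.+ 2 ∸ a)) ∷ []))

πLin : Lin GSym → Lin ZSym
πLin v = concatMap (λ { (c , s) → scale c (πG s) }) v

-- v lies in the ℚ-span of the defining relations of 𝒟_K, i.e. v = 0 in 𝒟_K
-- (equality of formal combinations = equality of all coefficients)
InRelSpanD : ℕ → Lin ZSym → Set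
InRelSpanD K v = ∃ λ (c : ℕ → ℚ) → ∀ (s : ZSym) →
  coeffZ v s ≡ coeffZ (sumL (range 1 (K ∸ 1)) (λ k₁ → scale (c k₁) (relD k₁ (K ∸ k₁)))) s

-- If k₁ + k₂ ≥ 3, every generator occurring in the relation has π(G) = δ_{d,0} Z (the δ_{k,1}-terms vanish), so π
-- maps the relation for (k₁, k₂; 0, 0) to the relation of 𝒟 for (k₁, k₂) and every relation with d₁ + d₂ > 0 to 0.
-- For k₁ = k₂ = 1 and D = d₁ + d₂ > 0 the image is -d₁!d₂! times the relation of 𝒟 for (d₁ + 1, d₂ + 1).
-- On Z_{D+2} only the correction term G[1; D+1] ↦ (D+1)! Z_{D+2} contributes. On Z_{a, D+2-a}, with A = a - 1,
-- one has d₁!(a-1)!/(a-1-d₂)! = d₁!d₂! C(A, d₂), and the shuffle terms give, via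
-- C(x, e) e! (A)_{x+y-e} = x! (A)_y C(A-y, x-e) for falling factorials,
--   Σ_e (-1)^{x-e} C(x, e) e! (A)_{D-e} = x! (A)_y Σ_f (-1)^f C(A-y, f) = x! y! δ_{A,y}   (x + y = D),
-- so that both sides agree. Finally, π maps the relation for (1, 1; 0, 0) to 0.

module Submission where

open import Defs

module FallingFactorial where

  open import Data.Nat using (ℕ; zero; suc; _+_; _*_; _∸_; _!; _≤_; _<_; z≤n; s≤s)
  import Data.Nat.Properties as ℕ
  open import Data.Nat.Combinatorics using (_C_; nCk+nC[k+1]≡[n+1]C[k+1]; k>n⇒nCk≡0)
  open import Data.Nat.Solver using (module +-*-Solver)
  open import Data.Sum using (inj₁; inj₂)
  open import Relation.Binary.PropositionalEquality
  open +-*-Solver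

  falling : ℕ → ℕ → ℕ
  falling n zero    = 1
  falling n (suc f) = n * falling (n ∸ 1) f

  falling-suc : ∀ n f → falling n (suc f) ≡ falling n f * (n ∸ f)
  falling-suc n zero    = trans (ℕ.*-identityʳ n) (sym (ℕ.+-identityʳ n))
  falling-suc n (suc f) = begin
    n * falling (n ∸ 1) (suc f)            ≡⟨ cong (n *_) (falling-suc (n ∸ 1) f) ⟩
    n * (falling (n ∸ 1) f * (n ∸ 1 ∸ f))  ≡⟨ cong (λ m → n * (falling (n ∸ 1) f * m)) (ℕ.∸-+-assoc n 1 f) ⟩
    n * (falling (n ∸ 1) f * (n ∸ suc f))  ≡⟨ ℕ.*-assoc n _ _ ⟨
    n * falling (n ∸ 1) f * (n ∸ suc f)    ∎
    where open ≡-Reasoning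

  falling≡C*! : ∀ n f → falling n f ≡ (n C f) * f !
  falling≡C*! zero    zero    = refl
  falling≡C*! zero    (suc f) = refl
  falling≡C*! (suc n) zero    = refl
  falling≡C*! (suc n) (suc f) with ℕ.≤-<-connex f n
  ... | inj₁ f≤n = begin
    suc n * falling n f
      ≡⟨ cong (suc n *_) (falling≡C*! n f) ⟩
    suc n * ((n C f) * f !)
      ≡⟨ cong (λ m → m * ((n C f) * f !)) (cong suc (ℕ.m+[n∸m]≡n f≤n)) ⟨
    (suc f + (n ∸ f)) * ((n C f) * f !)
      ≡⟨ solve 4 (λ a b c d → (a :+ b) :* (c :* d) := c :* (a :* d) :+ (c :* d) :* b) refl (suc f) (n ∸ f) (n C f) (f !) ⟩
    (n C f) * (suc f * f !) + (n C f) * f ! * (n ∸ f)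
      ≡⟨ cong ((n C f) * (suc f * f !) +_) (trans (falling-suc n f) (cong (_* (n ∸ f)) (falling≡C*! n f))) ⟨
    (n C f) * (suc f * f !) + falling n (suc f)
      ≡⟨ cong ((n C f) * (suc f * f !) +_) (falling≡C*! n (suc f)) ⟩
    (n C f) * (suc f * f !) + (n C suc f) * (suc f * f !)
      ≡⟨ ℕ.*-distribʳ-+ (suc f * f !) (n C f) (n C suc f) ⟨
    (n C f + n C suc f) * (suc f * f !)
      ≡⟨ cong (_* (suc f * f !)) (nCk+nC[k+1]≡[n+1]C[k+1] n f) ⟩
    (suc n C suc f) * (suc f * f !) ∎
    where open ≡-Reasoning
  ... | inj₂ n<f = begin
    suc n * falling n f           ≡⟨ cong (suc n *_) (falling≡C*! n f) ⟩
    suc n * ((n C f) * f !)       ≡⟨ cong (λ m → suc n * (m * f !)) (k>n⇒nCk≡0 n<f) ⟩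
    suc n * 0                     ≡⟨ ℕ.*-zeroʳ (suc n) ⟩
    0                             ≡⟨ cong (_* (suc f * f !)) (k>n⇒nCk≡0 (s≤s n<f)) ⟨
    (suc n C suc f) * (suc f * f !) ∎
    where open ≡-Reasoning

  falling-vanishes : ∀ {n f} → n < f → falling n f ≡ 0
  falling-vanishes {n} {f} n<f = trans (falling≡C*! n f) (cong (_* f !) (k>n⇒nCk≡0 n<f))

  falling*[n∸f]!≡n! : ∀ n f → f ≤ n → falling n f * (n ∸ f) ! ≡ n !
  falling*[n∸f]!≡n! n       zero    _         = ℕ.+-identityʳ (n !)
  falling*[n∸f]!≡n! (suc n) (suc f) (s≤s f≤n) =
    trans (ℕ.*-assoc (suc n) (falling n f) _) (cong (suc n *_) (falling*[n∸f]!≡n! n f f≤n))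

  falling-+ : ∀ n y f → falling n (y + f) ≡ falling n y * falling (n ∸ y) f
  falling-+ n zero    f = sym (ℕ.+-identityʳ (falling n f))
  falling-+ n (suc y) f = begin
    n * falling (n ∸ 1) (y + f)                         ≡⟨ cong (n *_) (falling-+ (n ∸ 1) y f) ⟩
    n * (falling (n ∸ 1) y * falling (n ∸ 1 ∸ y) f)     ≡⟨ cong (λ m → n * (falling (n ∸ 1) y * falling m f)) (ℕ.∸-+-assoc n 1 y) ⟩
    n * (falling (n ∸ 1) y * falling (n ∸ suc y) f)     ≡⟨ ℕ.*-assoc n _ _ ⟨
    n * falling (n ∸ 1) y * falling (n ∸ suc y) f       ∎
    where open ≡-Reasoning

  [e+f]Ce*e!*f!≡[e+f]! : ∀ e f → ((e + f) C e) * e ! * f ! ≡ (e + f) !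
  [e+f]Ce*e!*f!≡[e+f]! e f = begin
    ((e + f) C e) * e ! * f !         ≡⟨ cong (_* f !) (falling≡C*! (e + f) e) ⟨
    falling (e + f) e * f !           ≡⟨ cong (λ m → falling (e + f) e * m !) (ℕ.m+n∸m≡n e f) ⟨
    falling (e + f) e * (e + f ∸ e) ! ≡⟨ falling*[n∸f]!≡n! (e + f) e (ℕ.m≤m+n e f) ⟩
    (e + f) !                         ∎
    where open ≡-Reasoning

  C*!*falling : ∀ x e y A → e ≤ x →
    (x C e) * (e ! * falling A (x + y ∸ e)) ≡ x ! * falling A y * ((A ∸ y) C (x ∸ e))
  C*!*falling x e y A e≤x = begin
    (x C e) * (e ! * falling A (x + y ∸ e))
      ≡⟨ cong₂ (λ m n → (m C e) * (e ! * falling A n)) (sym x≡e+f) x+y∸e≡y+f ⟩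
    ((e + f) C e) * (e ! * falling A (y + f))
      ≡⟨ cong (λ m → ((e + f) C e) * (e ! * m)) (trans (falling-+ A y f) (cong (falling A y *_) (falling≡C*! (A ∸ y) f))) ⟩
    ((e + f) C e) * (e ! * (falling A y * (((A ∸ y) C f) * f !)))
      ≡⟨ solve 5 (λ c a b h k → c :* (a :* (b :* (h :* k))) := ((c :* a) :* k) :* b :* h) refl
           ((e + f) C e) (e !) (falling A y) ((A ∸ y) C f) (f !) ⟩
    ((e + f) C e) * e ! * f ! * falling A y * ((A ∸ y) C f)
      ≡⟨ cong (λ m → m * falling A y * ((A ∸ y) C f)) (trans ([e+f]Ce*e!*f!≡[e+f]! e f) (cong _! x≡e+f)) ⟩
    x ! * falling A y * ((A ∸ y) C f) ∎
    where
    open ≡-Reasoning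
    f = x ∸ e
    x≡e+f : e + f ≡ x
    x≡e+f = ℕ.m+[n∸m]≡n e≤x
    x+y∸e≡y+f : x + y ∸ e ≡ y + f
    x+y∸e≡y+f = trans (cong (_∸ e) (ℕ.+-comm x y)) (ℕ.+-∸-assoc y e≤x)

module Coefficients where

  open import Data.Nat as ℕ using (ℕ; zero; suc; NonZero; _≤_; _<_; z≤n; s≤s; _<ᵇ_; _∸_; _!)
  import Data.Nat.Properties as ℕ
  open import Data.Nat.Combinatorics using (_C_; k>n⇒nCk≡0; nCk+nC[k+1]≡[n+1]C[k+1])
  open import Data.Integer as ℤ using (+_)
  import Data.Integer.Properties as ℤ
  open import Data.Rational as ℚ using (ℚ; 0ℚ; 1ℚ; _+_; _*_; -_; _/_)
  import Data.Rational.Properties as ℚ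
  import Data.Rational.Unnormalised as ℚᵘ
  import Data.Rational.Unnormalised.Properties as ℚᵘ
  open import Data.Rational.Solver using (module +-*-Solver)
  open import Data.Bool using (Bool; true; false; if_then_else_; T)
  open import Data.Unit using (tt)
  open import Data.List using (List; []; _∷_; _++_; map; concatMap; applyUpTo)
  open import Data.List.Properties using (map-applyUpTo)
  open import Data.Product using (_×_; _,_)
  open import Data.Empty using (⊥-elim)
  open import Relation.Nullary using (yes; no)
  open import Relation.Binary using (tri<; tri≈; tri>)
  open import Relation.Binary.PropositionalEquality
  open import Function using (_∘_; id)
  open import Algebra.Bundles using (module CommutativeMonoid)
  open import Algebra.Properties.CommutativeSemigroup (CommutativeMonoid.commutativeSemigroup ℚ.+-0-commutativeMonoid)
    using () renaming (interchange to +-interchange)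
  open +-*-Solver
  open FallingFactorial

  toℚᵘ-/ : ∀ i n → ℚ.toℚᵘ (i / suc n) ℚᵘ.≃ ℚᵘ.mkℚᵘ i n
  toℚᵘ-/ i n = ℚ.toℚᵘ-fromℚᵘ (ℚᵘ.mkℚᵘ i n)

  ℕ→ℚ-+ : ∀ m n → ℕ→ℚ (m ℕ.+ n) ≡ ℕ→ℚ m + ℕ→ℚ n
  ℕ→ℚ-+ m n = ℚ.toℚᵘ-injective (begin
    ℚ.toℚᵘ (ℕ→ℚ (m ℕ.+ n))              ≈⟨ toℚᵘ-/ (+ (m ℕ.+ n)) 0 ⟩
    ℚᵘ.mkℚᵘ (+ (m ℕ.+ n)) 0              ≈⟨ ℚᵘ.*≡* (cong₂ ℤ._*_ integral refl) ⟩
    ℚᵘ.mkℚᵘ (+ m) 0 ℚᵘ.+ ℚᵘ.mkℚᵘ (+ n) 0 ≈⟨ ℚᵘ.+-cong (toℚᵘ-/ (+ m) 0) (toℚᵘ-/ (+ n) 0) ⟨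
    ℚ.toℚᵘ (ℕ→ℚ m) ℚᵘ.+ ℚ.toℚᵘ (ℕ→ℚ n)  ≈⟨ ℚ.toℚᵘ-homo-+ (ℕ→ℚ m) (ℕ→ℚ n) ⟨
    ℚ.toℚᵘ (ℕ→ℚ m + ℕ→ℚ n)              ∎)
    where
    open ℚᵘ.≃-Reasoning
    integral : + (m ℕ.+ n) ≡ + m ℤ.* + 1 ℤ.+ + n ℤ.* + 1
    integral = trans (ℤ.pos-+ m n) (sym (cong₂ ℤ._+_ (ℤ.*-identityʳ (+ m)) (ℤ.*-identityʳ (+ n))))

  ℕ→ℚ-* : ∀ m n → ℕ→ℚ (m ℕ.* n) ≡ ℕ→ℚ m * ℕ→ℚ n
  ℕ→ℚ-* m n = ℚ.toℚᵘ-injective (begin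
    ℚ.toℚᵘ (ℕ→ℚ (m ℕ.* n))              ≈⟨ toℚᵘ-/ (+ (m ℕ.* n)) 0 ⟩
    ℚᵘ.mkℚᵘ (+ (m ℕ.* n)) 0              ≈⟨ ℚᵘ.*≡* (cong (ℤ._* + 1) (ℤ.pos-* m n)) ⟩
    ℚᵘ.mkℚᵘ (+ m) 0 ℚᵘ.* ℚᵘ.mkℚᵘ (+ n) 0 ≈⟨ ℚᵘ.*-cong (toℚᵘ-/ (+ m) 0) (toℚᵘ-/ (+ n) 0) ⟨
    ℚ.toℚᵘ (ℕ→ℚ m) ℚᵘ.* ℚ.toℚᵘ (ℕ→ℚ n)  ≈⟨ ℚ.toℚᵘ-homo-* (ℕ→ℚ m) (ℕ→ℚ n) ⟨
    ℚ.toℚᵘ (ℕ→ℚ m * ℕ→ℚ n)              ∎)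
    where open ℚᵘ.≃-Reasoning

  [m*n]/n≡m : ∀ m n .{{_ : NonZero n}} → (+ (m ℕ.* n)) / n ≡ ℕ→ℚ m
  [m*n]/n≡m m (suc n) = ℚ.toℚᵘ-injective (begin
    ℚ.toℚᵘ ((+ (m ℕ.* suc n)) / suc n) ≈⟨ toℚᵘ-/ (+ (m ℕ.* suc n)) n ⟩
    ℚᵘ.mkℚᵘ (+ (m ℕ.* suc n)) n        ≈⟨ ℚᵘ.*≡* (trans (ℤ.*-identityʳ _) (ℤ.pos-* m (suc n))) ⟩
    ℚᵘ.mkℚᵘ (+ m) 0                    ≈⟨ toℚᵘ-/ (+ m) 0 ⟨
    ℚ.toℚᵘ (ℕ→ℚ m)                     ∎)
    where open ℚᵘ.≃-Reasoning

  [m/n]*n≡m : ∀ m n .{{_ : NonZero n}} → ((+ m) / n) * ℕ→ℚ n ≡ ℕ→ℚ m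
  [m/n]*n≡m m (suc n) = ℚ.toℚᵘ-injective (begin
    ℚ.toℚᵘ (((+ m) / suc n) * ℕ→ℚ (suc n))       ≈⟨ ℚ.toℚᵘ-homo-* ((+ m) / suc n) (ℕ→ℚ (suc n)) ⟩
    ℚ.toℚᵘ ((+ m) / suc n) ℚᵘ.* ℚ.toℚᵘ (ℕ→ℚ (suc n)) ≈⟨ ℚᵘ.*-cong (toℚᵘ-/ (+ m) n) (toℚᵘ-/ (+ suc n) 0) ⟩
    ℚᵘ.mkℚᵘ (+ m) n ℚᵘ.* ℚᵘ.mkℚᵘ (+ suc n) 0     ≈⟨ ℚᵘ.*≡* integral ⟩
    ℚᵘ.mkℚᵘ (+ m) 0                              ≈⟨ toℚᵘ-/ (+ m) 0 ⟨
    ℚ.toℚᵘ (ℕ→ℚ m)                               ∎)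
    where
    open ℚᵘ.≃-Reasoning
    integral : (+ m ℤ.* + suc n) ℤ.* + 1 ≡ + m ℤ.* + (suc n ℕ.* 1)
    integral = trans (ℤ.*-identityʳ _) (cong (λ k → + m ℤ.* + k) (sym (ℕ.*-identityʳ (suc n))))

  ∑ : {A : Set} → List A → (A → ℚ) → ℚ
  ∑ []       f = 0ℚ
  ∑ (x ∷ xs) f = f x + ∑ xs f

  module _ {A : Set} where

    ∑-cong : (xs : List A) {f g : A → ℚ} → (∀ x → f x ≡ g x) → ∑ xs f ≡ ∑ xs g
    ∑-cong []       f≗g = refl
    ∑-cong (x ∷ xs) f≗g = cong₂ _+_ (f≗g x) (∑-cong xs f≗g)

    ∑-zero : (xs : List A) → ∑ xs (λ _ → 0ℚ) ≡ 0ℚ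
    ∑-zero []       = refl
    ∑-zero (x ∷ xs) = trans (ℚ.+-identityˡ _) (∑-zero xs)

    ∑-vanishes : (xs : List A) (f : A → ℚ) → (∀ x → f x ≡ 0ℚ) → ∑ xs f ≡ 0ℚ
    ∑-vanishes xs f f≗0 = trans (∑-cong xs f≗0) (∑-zero xs)

    ∑-++ : (xs ys : List A) (f : A → ℚ) → ∑ (xs ++ ys) f ≡ ∑ xs f + ∑ ys f
    ∑-++ []       ys f = sym (ℚ.+-identityˡ _)
    ∑-++ (x ∷ xs) ys f = trans (cong (_+_ (f x)) (∑-++ xs ys f)) (sym (ℚ.+-assoc (f x) _ _))

    ∑-distrib-+ : (xs : List A) (f g : A → ℚ) → ∑ xs (λ x → f x + g x) ≡ ∑ xs f + ∑ xs g
    ∑-distrib-+ []       f g = refl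
    ∑-distrib-+ (x ∷ xs) f g = trans (cong (_+_ (f x + g x)) (∑-distrib-+ xs f g))
                                     (+-interchange (f x) (g x) (∑ xs f) (∑ xs g))

    ∑-distribˡ-* : (xs : List A) (c : ℚ) (f : A → ℚ) → ∑ xs (λ x → c * f x) ≡ c * ∑ xs f
    ∑-distribˡ-* []       c f = sym (ℚ.*-zeroʳ c)
    ∑-distribˡ-* (x ∷ xs) c f = trans (cong (_+_ (c * f x)) (∑-distribˡ-* xs c f)) (sym (ℚ.*-distribˡ-+ c (f x) _))

    ∑-distribʳ-* : (xs : List A) (c : ℚ) (f : A → ℚ) → ∑ xs (λ x → f x * c) ≡ ∑ xs f * c
    ∑-distribʳ-* xs c f = begin
      ∑ xs (λ x → f x * c) ≡⟨ ∑-cong xs (λ x → ℚ.*-comm (f x) c) ⟩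
      ∑ xs (λ x → c * f x) ≡⟨ ∑-distribˡ-* xs c f ⟩
      c * ∑ xs f           ≡⟨ ℚ.*-comm c (∑ xs f) ⟩
      ∑ xs f * c           ∎
      where open ≡-Reasoning

    ∑-neg : (xs : List A) (f : A → ℚ) → ∑ xs (λ x → - f x) ≡ - ∑ xs f
    ∑-neg []       f = refl
    ∑-neg (x ∷ xs) f = trans (cong (_+_ (- f x)) (∑-neg xs f)) (sym (ℚ.neg-distrib-+ (f x) (∑ xs f)))

    ∑-concatMap : {B : Set} (xs : List B) (g : B → List A) (f : A → ℚ) →
                  ∑ (concatMap g xs) f ≡ ∑ xs (λ x → ∑ (g x) f)
    ∑-concatMap []       g f = refl
    ∑-concatMap (x ∷ xs) g f = trans (∑-++ (g x) (concatMap g xs) f) (cong (_+_ (∑ (g x) f)) (∑-concatMap xs g f))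

    ∑-map : {B : Set} (xs : List B) (h : B → A) (f : A → ℚ) → ∑ (map h xs) f ≡ ∑ xs (f ∘ h)
    ∑-map []       h f = refl
    ∑-map (x ∷ xs) h f = cong (_+_ (f (h x))) (∑-map xs h f)

  ∑-comm : {A B : Set} (xs : List A) (ys : List B) (f : A → B → ℚ) →
           ∑ xs (λ x → ∑ ys (f x)) ≡ ∑ ys (λ y → ∑ xs (λ x → f x y))
  ∑-comm []       ys f = sym (∑-zero ys)
  ∑-comm (x ∷ xs) ys f = trans (cong (_+_ (∑ ys (f x))) (∑-comm xs ys f))
                               (sym (∑-distrib-+ ys (f x) (λ y → ∑ xs (λ x' → f x' y))))

  consecutive : ℕ → ℕ → List ℕ
  consecutive lo zero    = []
  consecutive lo (suc n) = lo ∷ consecutive (suc lo) n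

  range≡consecutive : ∀ a b → range a b ≡ consecutive a (suc b ∸ a)
  range≡consecutive a b =
    trans (map-applyUpTo id (a ℕ.+_) (suc b ∸ a)) (applyUpTo≡consecutive (a ℕ.+_) a (suc b ∸ a) (λ _ → refl))
    where
    applyUpTo≡consecutive : ∀ (f : ℕ → ℕ) lo n → (∀ i → f i ≡ lo ℕ.+ i) → applyUpTo f n ≡ consecutive lo n
    applyUpTo≡consecutive f lo zero    f≗lo+ = refl
    applyUpTo≡consecutive f lo (suc n) f≗lo+ = cong₂ _∷_ (trans (f≗lo+ 0) (ℕ.+-identityʳ lo))
      (applyUpTo≡consecutive (f ∘ suc) (suc lo) n (λ i → trans (f≗lo+ (suc i)) (ℕ.+-suc lo i)))

  consecutive-suc : ∀ lo n → consecutive (suc lo) n ≡ map suc (consecutive lo n)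
  consecutive-suc lo zero    = refl
  consecutive-suc lo (suc n) = cong (suc lo ∷_) (consecutive-suc (suc lo) n)

  consecutive-+ : ∀ lo m n → consecutive lo (m ℕ.+ n) ≡ consecutive lo m ++ consecutive (lo ℕ.+ m) n
  consecutive-+ lo zero    n = cong (λ l → consecutive l n) (sym (ℕ.+-identityʳ lo))
  consecutive-+ lo (suc m) n = cong (lo ∷_)
    (trans (consecutive-+ (suc lo) m n) (cong (λ l → consecutive (suc lo) m ++ consecutive l n) (sym (ℕ.+-suc lo m))))

  ∑-cong-consecutive : ∀ lo n {f g : ℕ → ℚ} → (∀ j → lo ≤ j → j < lo ℕ.+ n → f j ≡ g j) →
                       ∑ (consecutive lo n) f ≡ ∑ (consecutive lo n) g
  ∑-cong-consecutive lo zero    f≗g = refl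
  ∑-cong-consecutive lo (suc n) f≗g = cong₂ _+_
    (f≗g lo ℕ.≤-refl (subst (lo <_) (sym (ℕ.+-suc lo n)) (s≤s (ℕ.m≤m+n lo n))))
    (∑-cong-consecutive (suc lo) n (λ j lo<j j<hi → f≗g j (ℕ.<⇒≤ lo<j) (subst (j <_) (sym (ℕ.+-suc lo n)) j<hi)))

  δ-refl : ∀ n → δ n n ≡ 1ℚ
  δ-refl zero    = refl
  δ-refl (suc n) = δ-refl n

  δ-≢ : ∀ {m n} → m ≢ n → δ m n ≡ 0ℚ
  δ-≢ {zero}  {zero}  m≢n = ⊥-elim (m≢n refl)
  δ-≢ {zero}  {suc n} m≢n = refl
  δ-≢ {suc m} {zero}  m≢n = refl
  δ-≢ {suc m} {suc n} m≢n = δ-≢ (m≢n ∘ cong suc)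

  *δ-≢ : ∀ c {m n} → m ≢ n → c * δ m n ≡ 0ℚ
  *δ-≢ c m≢n = trans (cong (c *_) (δ-≢ m≢n)) (ℚ.*-zeroʳ c)

  ∑-δ-below : ∀ lo n J (f : ℕ → ℚ) → J < lo → ∑ (consecutive lo n) (λ j → δ j J * f j) ≡ 0ℚ
  ∑-δ-below lo zero    J f J<lo = refl
  ∑-δ-below lo (suc n) J f J<lo = begin
    δ lo J * f lo + ∑ (consecutive (suc lo) n) (λ j → δ j J * f j)
      ≡⟨ cong₂ _+_ (cong (_* f lo) (δ-≢ (λ lo≡J → ℕ.<-irrefl (sym lo≡J) J<lo)))
                   (∑-δ-below (suc lo) n J f (ℕ.m<n⇒m<1+n J<lo)) ⟩
    0ℚ * f lo + 0ℚ
      ≡⟨ cong (_+ 0ℚ) (ℚ.*-zeroˡ (f lo)) ⟩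
    0ℚ ∎
    where open ≡-Reasoning

  ∑-δ : ∀ lo n J (f : ℕ → ℚ) → lo ≤ J → J < lo ℕ.+ n → ∑ (consecutive lo n) (λ j → δ j J * f j) ≡ f J
  ∑-δ lo zero    J f lo≤J J<lo+0 = ⊥-elim (ℕ.<-irrefl refl (ℕ.≤-<-trans lo≤J (subst (J <_) (ℕ.+-identityʳ lo) J<lo+0)))
  ∑-δ lo (suc n) J f lo≤J J<hi with lo ℕ.≟ J
  ... | yes refl = begin
    δ lo lo * f lo + ∑ (consecutive (suc lo) n) (λ j → δ j lo * f j)
      ≡⟨ cong₂ _+_ (trans (cong (_* f lo) (δ-refl lo)) (ℚ.*-identityˡ (f lo))) (∑-δ-below (suc lo) n lo f ℕ.≤-refl) ⟩
    f lo + 0ℚ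
      ≡⟨ ℚ.+-identityʳ (f lo) ⟩
    f lo ∎
    where open ≡-Reasoning
  ... | no lo≢J = begin
    δ lo J * f lo + ∑ (consecutive (suc lo) n) (λ j → δ j J * f j)
      ≡⟨ cong₂ _+_ (trans (cong (_* f lo) (δ-≢ lo≢J)) (ℚ.*-zeroˡ (f lo)))
                   (∑-δ (suc lo) n J f (ℕ.≤∧≢⇒< lo≤J lo≢J) (subst (J <_) (ℕ.+-suc lo n) J<hi)) ⟩
    0ℚ + f J
      ≡⟨ ℚ.+-identityˡ (f J) ⟩
    f J ∎
    where open ≡-Reasoning

  indicator : ZSym → ZSym → ℚ
  indicator t s = if eqZ t s then 1ℚ else 0ℚ

  if-else-0-factor : ∀ (b : Bool) c → (if b then c else 0ℚ) ≡ c * (if b then 1ℚ else 0ℚ)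
  if-else-0-factor true  c = sym (ℚ.*-identityʳ c)
  if-else-0-factor false c = sym (ℚ.*-zeroʳ c)

  coeffZ-[_] : ∀ c t s → coeffZ ((c , t) ∷ []) s ≡ c * indicator t s
  coeffZ-[ c ] t s = trans (ℚ.+-identityʳ _) (if-else-0-factor (eqZ t s) c)

  coeffZ-++ : ∀ v w s → coeffZ (v ++ w) s ≡ coeffZ v s + coeffZ w s
  coeffZ-++ []            w s = sym (ℚ.+-identityˡ _)
  coeffZ-++ ((c , t) ∷ v) w s =
    trans (cong (_+_ (if eqZ t s then c else 0ℚ)) (coeffZ-++ v w s)) (sym (ℚ.+-assoc (if eqZ t s then c else 0ℚ) (coeffZ v s) (coeffZ w s)))

  coeffZ-scale : ∀ c v s → coeffZ (scale c v) s ≡ c * coeffZ v s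
  coeffZ-scale c []            s = sym (ℚ.*-zeroʳ c)
  coeffZ-scale c ((x , t) ∷ v) s = begin
    (if eqZ t s then c * x else 0ℚ) + coeffZ (scale c v) s
      ≡⟨ cong₂ _+_ (if-scale (eqZ t s)) (coeffZ-scale c v s) ⟩
    c * (if eqZ t s then x else 0ℚ) + c * coeffZ v s
      ≡⟨ ℚ.*-distribˡ-+ c _ (coeffZ v s) ⟨
    c * ((if eqZ t s then x else 0ℚ) + coeffZ v s) ∎
    where
    open ≡-Reasoning
    if-scale : ∀ b → (if b then c * x else 0ℚ) ≡ c * (if b then x else 0ℚ)
    if-scale true  = refl
    if-scale false = sym (ℚ.*-zeroʳ c)

  coeffZ-sumL : ∀ {A : Set} (is : List A) (f : A → Lin ZSym) s → coeffZ (sumL is f) s ≡ ∑ is (λ i → coeffZ (f i) s)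
  coeffZ-sumL []       f s = refl
  coeffZ-sumL (i ∷ is) f s = trans (coeffZ-++ (f i) (sumL is f) s) (cong (_+_ (coeffZ (f i) s)) (coeffZ-sumL is f s))

  weigh : {S : Set} → (S → ℚ) → ℚ × S → ℚ
  weigh f (c , g) = c * f g

  coeffZ-πLin : ∀ v s → coeffZ (πLin v) s ≡ ∑ v (weigh (λ g → coeffZ (πG g) s))
  coeffZ-πLin []            s = refl
  coeffZ-πLin ((c , g) ∷ v) s =
    trans (coeffZ-++ (scale c (πG g)) (πLin v) s) (cong₂ _+_ (coeffZ-scale c (πG g) s) (coeffZ-πLin v s))

  shuffleBinomial : ℕ → ℕ → ℕ → ℕ
  shuffleBinomial k₁ k₂ j = ((j ∸ 1) C (k₁ ∸ 1)) ℕ.+ ((j ∸ 1) C (k₂ ∸ 1))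

  shuffleCoeff : ℕ → ℕ → ℕ → ℕ → ℕ → ℕ → ℚ
  shuffleCoeff k₁ k₂ d₁ d₂ l e =
    - ( ℕ→ℚ (((l ∸ 1) C (k₁ ∸ 1)) ℕ.* (d₁ C e)) * sgn (d₁ ∸ e)
      + ℕ→ℚ (((l ∸ 1) C (k₂ ∸ 1)) ℕ.* (d₂ C e)) * sgn (d₂ ∸ e))

  correctionCoeff : ℕ → ℕ → ℕ → ℕ → ℚ
  correctionCoeff k₁ k₂ d₁ d₂ =
    - (((+ (d₁ ! ℕ.* d₂ !)) / (suc (d₁ ℕ.+ d₂) !)) {{ℕ._!≢0 (suc (d₁ ℕ.+ d₂))}} * ℕ→ℚ ((k₁ ℕ.+ k₂ ∸ 2) C (k₁ ∸ 1)))

  ∑-relE : ∀ (f : GSym → ℚ) k₁ k₂ d₁ d₂ → let k = k₁ ℕ.+ k₂; d = d₁ ℕ.+ d₂ in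
    ∑ (relE k₁ k₂ d₁ d₂) (weigh f) ≡
      f (G₂ k₁ k₂ d₁ d₂) + (f (G₂ k₂ k₁ d₂ d₁) + (f (G₁ k d) +
        (∑ (range 1 (k ∸ 1)) (λ l → ∑ (range 0 d) (λ e → shuffleCoeff k₁ k₂ d₁ d₂ l e * f (G₂ l (k ∸ l) e (d ∸ e))))
         + correctionCoeff k₁ k₂ d₁ d₂ * f (G₁ (k ∸ 1) (suc d)))))
  ∑-relE f k₁ k₂ d₁ d₂ =
    cong₂ _+_ (ℚ.*-identityˡ (f (G₂ k₁ k₂ d₁ d₂))) (cong₂ _+_ (ℚ.*-identityˡ (f (G₂ k₂ k₁ d₂ d₁)))
      (cong₂ _+_ (ℚ.*-identityˡ (f (G₁ k d))) (begin
      ∑ (shuffles ++ (correction ∷ [])) (weigh f)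
        ≡⟨ ∑-++ shuffles (correction ∷ []) (weigh f) ⟩
      ∑ shuffles (weigh f) + (weigh f correction + 0ℚ)
        ≡⟨ cong₂ _+_ shuffles-sum (ℚ.+-identityʳ (weigh f correction)) ⟩
      ∑ (range 1 (k ∸ 1)) (λ l → ∑ (range 0 d) (λ e → shuffleCoeff k₁ k₂ d₁ d₂ l e * f (G₂ l (k ∸ l) e (d ∸ e))))
        + weigh f correction ∎)))
    where
    open ≡-Reasoning
    k = k₁ ℕ.+ k₂
    d = d₁ ℕ.+ d₂
    shuffle : ℕ → ℕ → Lin GSym
    shuffle l e = (shuffleCoeff k₁ k₂ d₁ d₂ l e , G₂ l (k ∸ l) e (d ∸ e)) ∷ []
    shuffles : Lin GSym
    shuffles = sumL (range 1 (k ∸ 1)) (λ l → sumL (range 0 d) (shuffle l))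
    correction : ℚ × GSym
    correction = correctionCoeff k₁ k₂ d₁ d₂ , G₁ (k ∸ 1) (suc d)
    shuffles-sum : ∑ shuffles (weigh f) ≡
      ∑ (range 1 (k ∸ 1)) (λ l → ∑ (range 0 d) (λ e → shuffleCoeff k₁ k₂ d₁ d₂ l e * f (G₂ l (k ∸ l) e (d ∸ e))))
    shuffles-sum = trans (∑-concatMap (range 1 (k ∸ 1)) (λ l → sumL (range 0 d) (shuffle l)) (weigh f))
      (∑-cong (range 1 (k ∸ 1)) λ l → trans (∑-concatMap (range 0 d) (shuffle l) (weigh f))
        (∑-cong (range 0 d) λ e → ℚ.+-identityʳ (weigh f (shuffleCoeff k₁ k₂ d₁ d₂ l e , G₂ l (k ∸ l) e (d ∸ e)))))

  coeffZ-relD : ∀ k₁ k₂ s → let k = k₁ ℕ.+ k₂ in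
    coeffZ (relD k₁ k₂) s ≡
      indicator (Z₂ k₁ k₂) s + (indicator (Z₂ k₂ k₁) s + (indicator (Z₁ k) s +
        ∑ (range 1 (k ∸ 1)) (λ j → - ℕ→ℚ (shuffleBinomial k₁ k₂ j) * indicator (Z₂ j (k ∸ j)) s)))
  coeffZ-relD k₁ k₂ s = cong (λ x → indicator (Z₂ k₁ k₂) s + (indicator (Z₂ k₂ k₁) s + (indicator (Z₁ k) s + x)))
    (trans (coeffZ-sumL (range 1 (k ∸ 1)) _ s)
           (∑-cong (range 1 (k ∸ 1)) λ j → coeffZ-[ - ℕ→ℚ (shuffleBinomial k₁ k₂ j) ] (Z₂ j (k ∸ j)) s))
    where k = k₁ ℕ.+ k₂

  diagIndicator : ℕ → ZSym → ℕ → ℚ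
  diagIndicator D s a = indicator (Z₂ a (suc (suc D) ∸ a)) s

  coeffZ-πG-G₁ : ∀ k d s →
    coeffZ (πG (G₁ k d)) s ≡ δ d 0 * indicator (Z₁ k) s + δ k 1 * ℕ→ℚ (d !) * indicator (Z₁ (suc d)) s
  coeffZ-πG-G₁ k d s = cong₂ _+_ (if-else-0-factor (eqZ (Z₁ k) s) (δ d 0)) (coeffZ-[ δ k 1 * ℕ→ℚ (d !) ] (Z₁ (suc d)) s)

  coeffZ-πG-G₂ : ∀ k₁ k₂ d₁ d₂ s → coeffZ (πG (G₂ k₁ k₂ d₁ d₂)) s ≡
    δ d₁ 0 * δ d₂ 0 * indicator (Z₂ k₁ k₂) s
      + δ k₁ 1 * δ k₂ 1 * ∑ (consecutive 1 (suc (d₁ ℕ.+ d₂))) (λ a → πcoef d₁ d₂ a * diagIndicator (d₁ ℕ.+ d₂) s a)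
  coeffZ-πG-G₂ k₁ k₂ d₁ d₂ s = cong₂ _+_ (if-else-0-factor (eqZ (Z₂ k₁ k₂) s) (δ d₁ 0 * δ d₂ 0)) (begin
    coeffZ (scale (δ k₁ 1 * δ k₂ 1) (sumL (range 1 (suc D)) term)) s
      ≡⟨ coeffZ-scale (δ k₁ 1 * δ k₂ 1) (sumL (range 1 (suc D)) term) s ⟩
    δ k₁ 1 * δ k₂ 1 * coeffZ (sumL (range 1 (suc D)) term) s
      ≡⟨ cong (δ k₁ 1 * δ k₂ 1 *_) (trans (coeffZ-sumL (range 1 (suc D)) term s)
                                          (cong (λ as → ∑ as (λ a → coeffZ (term a) s)) (range≡consecutive 1 (suc D)))) ⟩
    δ k₁ 1 * δ k₂ 1 * ∑ (consecutive 1 (suc D)) (λ a → coeffZ (term a) s)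
      ≡⟨ cong (δ k₁ 1 * δ k₂ 1 *_) (∑-cong (consecutive 1 (suc D)) λ a →
           trans (coeffZ-[ πcoef d₁ d₂ a ] (Z₂ a (D ℕ.+ 2 ∸ a)) s)
                 (cong (λ n → πcoef d₁ d₂ a * indicator (Z₂ a (n ∸ a)) s) (ℕ.+-comm D 2))) ⟩
    δ k₁ 1 * δ k₂ 1 * ∑ (consecutive 1 (suc D)) (λ a → πcoef d₁ d₂ a * diagIndicator D s a) ∎)
    where
    open ≡-Reasoning
    D = d₁ ℕ.+ d₂
    term : ℕ → Lin ZSym
    term a = (πcoef d₁ d₂ a , Z₂ a (D ℕ.+ 2 ∸ a)) ∷ []

  δ-≥2 : ∀ {k} → 2 ≤ k → δ k 1 ≡ 0ℚ
  δ-≥2 {suc (suc k)} _         = refl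
  δ-≥2 {suc zero}    (s≤s ())

  δ₀-product-vanishes : ∀ {d₁ d₂} → 1 ≤ d₁ ℕ.+ d₂ → δ d₁ 0 * δ d₂ 0 ≡ 0ℚ
  δ₀-product-vanishes {zero}  {suc d₂} _ = refl
  δ₀-product-vanishes {suc d₁} {d₂}    _ = ℚ.*-zeroˡ (δ d₂ 0)

  δ₁-product-vanishes : ∀ {k₁ k₂} → 3 ≤ k₁ ℕ.+ k₂ → δ k₁ 1 * δ k₂ 1 ≡ 0ℚ
  δ₁-product-vanishes {zero}          {k₂}            _ = ℚ.*-zeroˡ (δ k₂ 1)
  δ₁-product-vanishes {suc (suc k₁)}  {k₂}            _ = ℚ.*-zeroˡ (δ k₂ 1)
  δ₁-product-vanishes {suc zero}      {suc (suc k₂)}  _ = refl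
  δ₁-product-vanishes {suc zero}      {suc zero}      (s≤s (s≤s ()))
  δ₁-product-vanishes {suc zero}      {zero}          (s≤s ())

  πG-G₁-regular : ∀ k d s → 2 ≤ k → coeffZ (πG (G₁ k d)) s ≡ δ d 0 * indicator (Z₁ k) s
  πG-G₁-regular k d s 2≤k = begin
    coeffZ (πG (G₁ k d)) s
      ≡⟨ coeffZ-πG-G₁ k d s ⟩
    δ d 0 * indicator (Z₁ k) s + δ k 1 * ℕ→ℚ (d !) * indicator (Z₁ (suc d)) s
      ≡⟨ cong (λ x → δ d 0 * indicator (Z₁ k) s + x * ℕ→ℚ (d !) * indicator (Z₁ (suc d)) s) (δ-≥2 2≤k) ⟩
    δ d 0 * indicator (Z₁ k) s + 0ℚ * ℕ→ℚ (d !) * indicator (Z₁ (suc d)) s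
      ≡⟨ cong (_+_ (δ d 0 * indicator (Z₁ k) s)) (trans (cong (_* indicator (Z₁ (suc d)) s) (ℚ.*-zeroˡ (ℕ→ℚ (d !))))
                                                      (ℚ.*-zeroˡ (indicator (Z₁ (suc d)) s))) ⟩
    δ d 0 * indicator (Z₁ k) s + 0ℚ
      ≡⟨ ℚ.+-identityʳ (δ d 0 * indicator (Z₁ k) s) ⟩
    δ d 0 * indicator (Z₁ k) s ∎
    where open ≡-Reasoning

  πG-G₂-regular : ∀ k₁ k₂ d₁ d₂ s → 3 ≤ k₁ ℕ.+ k₂ →
    coeffZ (πG (G₂ k₁ k₂ d₁ d₂)) s ≡ δ d₁ 0 * δ d₂ 0 * indicator (Z₂ k₁ k₂) s
  πG-G₂-regular k₁ k₂ d₁ d₂ s 3≤k = begin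
    coeffZ (πG (G₂ k₁ k₂ d₁ d₂)) s
      ≡⟨ coeffZ-πG-G₂ k₁ k₂ d₁ d₂ s ⟩
    δ d₁ 0 * δ d₂ 0 * indicator (Z₂ k₁ k₂) s + δ k₁ 1 * δ k₂ 1 * Σa
      ≡⟨ cong (λ x → δ d₁ 0 * δ d₂ 0 * indicator (Z₂ k₁ k₂) s + x * Σa) (δ₁-product-vanishes {k₁} {k₂} 3≤k) ⟩
    δ d₁ 0 * δ d₂ 0 * indicator (Z₂ k₁ k₂) s + 0ℚ * Σa
      ≡⟨ trans (cong (_+_ (δ d₁ 0 * δ d₂ 0 * indicator (Z₂ k₁ k₂) s)) (ℚ.*-zeroˡ Σa))
               (ℚ.+-identityʳ (δ d₁ 0 * δ d₂ 0 * indicator (Z₂ k₁ k₂) s)) ⟩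
    δ d₁ 0 * δ d₂ 0 * indicator (Z₂ k₁ k₂) s ∎
    where
    open ≡-Reasoning
    Σa = ∑ (consecutive 1 (suc (d₁ ℕ.+ d₂))) (λ a → πcoef d₁ d₂ a * diagIndicator (d₁ ℕ.+ d₂) s a)

  -- Relations with (k₁, k₂) ≠ (1, 1)

  πG-G₁-vanishes : ∀ k d s → 2 ≤ k → 1 ≤ d → coeffZ (πG (G₁ k d)) s ≡ 0ℚ
  πG-G₁-vanishes k (suc d) s 2≤k _ = trans (πG-G₁-regular k (suc d) s 2≤k) (ℚ.*-zeroˡ (indicator (Z₁ k) s))

  πG-G₂-vanishes : ∀ k₁ k₂ d₁ d₂ s → 3 ≤ k₁ ℕ.+ k₂ → 1 ≤ d₁ ℕ.+ d₂ →
                   coeffZ (πG (G₂ k₁ k₂ d₁ d₂)) s ≡ 0ℚ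
  πG-G₂-vanishes k₁ k₂ d₁ d₂ s 3≤k 1≤d = begin
    coeffZ (πG (G₂ k₁ k₂ d₁ d₂)) s            ≡⟨ πG-G₂-regular k₁ k₂ d₁ d₂ s 3≤k ⟩
    δ d₁ 0 * δ d₂ 0 * indicator (Z₂ k₁ k₂) s  ≡⟨ cong (_* indicator (Z₂ k₁ k₂) s) (δ₀-product-vanishes {d₁} {d₂} 1≤d) ⟩
    0ℚ * indicator (Z₂ k₁ k₂) s               ≡⟨ ℚ.*-zeroˡ (indicator (Z₂ k₁ k₂) s) ⟩
    0ℚ                                        ∎
    where open ≡-Reasoning

  π-relE-regular-vanishes : ∀ k₁ k₂ d₁ d₂ → 3 ≤ k₁ ℕ.+ k₂ → 1 ≤ d₁ ℕ.+ d₂ → ∀ s →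
    coeffZ (πLin (relE k₁ k₂ d₁ d₂)) s ≡ 0ℚ
  π-relE-regular-vanishes k₁ k₂ d₁ d₂ 3≤k 1≤d s =
    trans (coeffZ-πLin (relE k₁ k₂ d₁ d₂) s) (trans (∑-relE f k₁ k₂ d₁ d₂)
      (cong₂ _+_ (πG-G₂-vanishes k₁ k₂ d₁ d₂ s 3≤k 1≤d)
      (cong₂ _+_ (πG-G₂-vanishes k₂ k₁ d₂ d₁ s (subst (3 ≤_) (ℕ.+-comm k₁ k₂) 3≤k) (subst (1 ≤_) (ℕ.+-comm d₁ d₂) 1≤d))
      (cong₂ _+_ (πG-G₁-vanishes k d s (ℕ.≤-trans (ℕ.n≤1+n 2) 3≤k) 1≤d)
      (cong₂ _+_ shuffles-vanish correction-vanishes)))))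
    where
    k = k₁ ℕ.+ k₂
    d = d₁ ℕ.+ d₂
    f = λ g → coeffZ (πG g) s
    shuffles-vanish : ∑ (range 1 (k ∸ 1)) (λ l → ∑ (range 0 d) (λ e →
                        shuffleCoeff k₁ k₂ d₁ d₂ l e * f (G₂ l (k ∸ l) e (d ∸ e)))) ≡ 0ℚ
    shuffles-vanish = ∑-vanishes (range 1 (k ∸ 1)) _ λ l → ∑-vanishes (range 0 d) _ λ e →
      trans (cong (shuffleCoeff k₁ k₂ d₁ d₂ l e *_)
                  (πG-G₂-vanishes l (k ∸ l) e (d ∸ e) s (ℕ.≤-trans 3≤k (ℕ.m≤n+m∸n k l)) (ℕ.≤-trans 1≤d (ℕ.m≤n+m∸n d e))))
            (ℚ.*-zeroʳ (shuffleCoeff k₁ k₂ d₁ d₂ l e))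
    correction-vanishes : correctionCoeff k₁ k₂ d₁ d₂ * f (G₁ (k ∸ 1) (suc d)) ≡ 0ℚ
    correction-vanishes = trans (cong (correctionCoeff k₁ k₂ d₁ d₂ *_)
                                      (πG-G₁-vanishes (k ∸ 1) (suc d) s (ℕ.∸-monoˡ-≤ 1 3≤k) (s≤s z≤n)))
                                (ℚ.*-zeroʳ (correctionCoeff k₁ k₂ d₁ d₂))

  shuffleCoeff-depth0 : ∀ k₁ k₂ l → shuffleCoeff k₁ k₂ 0 0 l 0 ≡ - ℕ→ℚ (shuffleBinomial k₁ k₂ l)
  shuffleCoeff-depth0 k₁ k₂ l = cong -_ (begin
    ℕ→ℚ (a ℕ.* 1) * 1ℚ + ℕ→ℚ (b ℕ.* 1) * 1ℚ ≡⟨ cong₂ _+_ (drop-1 a) (drop-1 b) ⟩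
    ℕ→ℚ a + ℕ→ℚ b                           ≡⟨ ℕ→ℚ-+ a b ⟨
    ℕ→ℚ (a ℕ.+ b)                           ∎)
    where
    open ≡-Reasoning
    a = (l ∸ 1) C (k₁ ∸ 1)
    b = (l ∸ 1) C (k₂ ∸ 1)
    drop-1 : ∀ n → ℕ→ℚ (n ℕ.* 1) * 1ℚ ≡ ℕ→ℚ n
    drop-1 n = trans (ℚ.*-identityʳ _) (cong ℕ→ℚ (ℕ.*-identityʳ n))

  π-relE-regular-depth0 : ∀ k₁ k₂ → 3 ≤ k₁ ℕ.+ k₂ → ∀ s → coeffZ (πLin (relE k₁ k₂ 0 0)) s ≡ coeffZ (relD k₁ k₂) s
  π-relE-regular-depth0 k₁ k₂ 3≤k s =
    trans (coeffZ-πLin (relE k₁ k₂ 0 0) s) (trans (∑-relE f k₁ k₂ 0 0)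
      (trans (cong₂ _+_ (regular₂ k₁ k₂ 3≤k)
             (cong₂ _+_ (regular₂ k₂ k₁ (subst (3 ≤_) (ℕ.+-comm k₁ k₂) 3≤k))
             (cong₂ _+_ (trans (πG-G₁-regular k 0 s (ℕ.≤-trans (ℕ.n≤1+n 2) 3≤k)) (ℚ.*-identityˡ (indicator (Z₁ k) s)))
             (trans (cong₂ _+_ shuffles correction-vanishes) (ℚ.+-identityʳ _)))))
      (sym (coeffZ-relD k₁ k₂ s))))
    where
    k = k₁ ℕ.+ k₂
    f = λ g → coeffZ (πG g) s
    regular₂ : ∀ a b → 3 ≤ a ℕ.+ b → f (G₂ a b 0 0) ≡ indicator (Z₂ a b) s
    regular₂ a b 3≤a+b = trans (πG-G₂-regular a b 0 0 s 3≤a+b) (ℚ.*-identityˡ (indicator (Z₂ a b) s))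
    shuffles : ∑ (range 1 (k ∸ 1)) (λ l → shuffleCoeff k₁ k₂ 0 0 l 0 * f (G₂ l (k ∸ l) 0 0) + 0ℚ)
             ≡ ∑ (range 1 (k ∸ 1)) (λ l → - ℕ→ℚ (shuffleBinomial k₁ k₂ l) * indicator (Z₂ l (k ∸ l)) s)
    shuffles = ∑-cong (range 1 (k ∸ 1)) λ l → trans (ℚ.+-identityʳ _)
      (cong₂ _*_ (shuffleCoeff-depth0 k₁ k₂ l) (regular₂ l (k ∸ l) (ℕ.≤-trans 3≤k (ℕ.m≤n+m∸n k l))))
    correction-vanishes : correctionCoeff k₁ k₂ 0 0 * f (G₁ (k ∸ 1) 1) ≡ 0ℚ
    correction-vanishes = trans (cong (correctionCoeff k₁ k₂ 0 0 *_) (πG-G₁-vanishes (k ∸ 1) 1 s (ℕ.∸-monoˡ-≤ 1 3≤k) (s≤s z≤n)))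
                                (ℚ.*-zeroʳ (correctionCoeff k₁ k₂ 0 0))

  -- Alternating binomial sums

  alternatingSum : ℕ → ℕ → ℚ
  alternatingSum x n = ∑ (consecutive 0 (suc x)) (λ e → sgn (x ∸ e) * ℕ→ℚ (n C (x ∸ e)))

  alternatingSum-suc : ∀ x n → alternatingSum (suc x) n ≡ sgn (suc x) * ℕ→ℚ (n C suc x) + alternatingSum x n
  alternatingSum-suc x n = cong (_+_ (sgn (suc x) * ℕ→ℚ (n C suc x)))
    (trans (cong (λ es → ∑ es (λ e → sgn (suc x ∸ e) * ℕ→ℚ (n C (suc x ∸ e)))) (consecutive-suc 0 (suc x)))
           (∑-map (consecutive 0 (suc x)) suc (λ e → sgn (suc x ∸ e) * ℕ→ℚ (n C (suc x ∸ e)))))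

  alternatingSum-0 : ∀ x → alternatingSum x 0 ≡ 1ℚ
  alternatingSum-0 zero    = refl
  alternatingSum-0 (suc x) = begin
    alternatingSum (suc x) 0                   ≡⟨ alternatingSum-suc x 0 ⟩
    sgn (suc x) * 0ℚ + alternatingSum x 0      ≡⟨ cong₂ _+_ (ℚ.*-zeroʳ (sgn (suc x))) (alternatingSum-0 x) ⟩
    0ℚ + 1ℚ                                    ≡⟨⟩
    1ℚ                                         ∎
    where open ≡-Reasoning

  -- Pascal's rule telescopes the sum.
  alternatingSum-1+ : ∀ x m → alternatingSum x (suc m) ≡ sgn x * ℕ→ℚ (m C x)
  alternatingSum-1+ zero    m = ℚ.+-identityʳ _
  alternatingSum-1+ (suc x) m = begin
    alternatingSum (suc x) (suc m)
      ≡⟨ alternatingSum-suc x (suc m) ⟩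
    - sgn x * ℕ→ℚ (suc m C suc x) + alternatingSum x (suc m)
      ≡⟨ cong₂ (λ a b → - sgn x * a + b)
           (trans (cong ℕ→ℚ (sym (nCk+nC[k+1]≡[n+1]C[k+1] m x))) (ℕ→ℚ-+ (m C x) (m C suc x)))
           (alternatingSum-1+ x m) ⟩
    - sgn x * (ℕ→ℚ (m C x) + ℕ→ℚ (m C suc x)) + sgn x * ℕ→ℚ (m C x)
      ≡⟨ solve 3 (λ s a b → (:- s) :* (a :+ b) :+ s :* a := (:- s) :* b) refl (sgn x) (ℕ→ℚ (m C x)) (ℕ→ℚ (m C suc x)) ⟩
    - sgn x * ℕ→ℚ (m C suc x) ∎
    where open ≡-Reasoning

  alternatingSum≡δ : ∀ x n → n ≤ x → alternatingSum x n ≡ δ n 0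
  alternatingSum≡δ x zero    _   = alternatingSum-0 x
  alternatingSum≡δ x (suc m) m<x = trans (alternatingSum-1+ x m)
    (trans (cong (λ c → sgn x * ℕ→ℚ c) (k>n⇒nCk≡0 m<x)) (ℚ.*-zeroʳ (sgn x)))

  πcoef-falling : ∀ e y A → πcoef e y (suc A) ≡ ℕ→ℚ (e ! ℕ.* falling A y)
  πcoef-falling e y A with A <ᵇ y in A<ᵇy
  ... | true  = sym (trans (cong (λ m → ℕ→ℚ (e ! ℕ.* m)) (falling-vanishes (ℕ.<ᵇ⇒< A y (subst T (sym A<ᵇy) tt))))
                           (cong ℕ→ℚ (ℕ.*-zeroʳ (e !))))
  ... | false = trans (cong (λ m → ((+ m) / (A ∸ y) !) {{ℕ._!≢0 (A ∸ y)}}) (sym e!*falling*[A∸y]!≡e!*A!))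
                      ([m*n]/n≡m (e ! ℕ.* falling A y) ((A ∸ y) !) {{ℕ._!≢0 (A ∸ y)}})
    where
    y≤A : y ≤ A
    y≤A = ℕ.≮⇒≥ (λ A<y → subst T A<ᵇy (ℕ.<⇒<ᵇ A<y))
    e!*falling*[A∸y]!≡e!*A! : e ! ℕ.* falling A y ℕ.* (A ∸ y) ! ≡ e ! ℕ.* A !
    e!*falling*[A∸y]!≡e!*A! = trans (ℕ.*-assoc (e !) (falling A y) _) (cong (e ! ℕ.*_) (falling*[n∸f]!≡n! A y y≤A))

  πcoef-binomial : ∀ x y A → πcoef x y (suc A) ≡ ℕ→ℚ (x ! ℕ.* y !) * ℕ→ℚ (A C y)
  πcoef-binomial x y A = begin
    πcoef x y (suc A)                   ≡⟨ πcoef-falling x y A ⟩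
    ℕ→ℚ (x ! ℕ.* falling A y)           ≡⟨ cong (λ m → ℕ→ℚ (x ! ℕ.* m)) (trans (falling≡C*! A y) (ℕ.*-comm (A C y) (y !))) ⟩
    ℕ→ℚ (x ! ℕ.* (y ! ℕ.* (A C y)))     ≡⟨ cong ℕ→ℚ (ℕ.*-assoc (x !) (y !) (A C y)) ⟨
    ℕ→ℚ (x ! ℕ.* y ! ℕ.* (A C y))       ≡⟨ ℕ→ℚ-* (x ! ℕ.* y !) (A C y) ⟩
    ℕ→ℚ (x ! ℕ.* y !) * ℕ→ℚ (A C y)     ∎
    where open ≡-Reasoning

  falling*alternatingSum : ∀ x y A → A ≤ x ℕ.+ y →
    ℕ→ℚ (x ! ℕ.* falling A y) * alternatingSum x (A ∸ y) ≡ ℕ→ℚ (x ! ℕ.* y !) * δ A y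
  falling*alternatingSum x y A A≤x+y with ℕ.<-cmp A y
  ... | tri< A<y A≢y _ = begin
    ℕ→ℚ (x ! ℕ.* falling A y) * alternatingSum x (A ∸ y)
      ≡⟨ cong (λ m → ℕ→ℚ m * alternatingSum x (A ∸ y)) (trans (cong (x ! ℕ.*_) (falling-vanishes A<y)) (ℕ.*-zeroʳ (x !))) ⟩
    0ℚ * alternatingSum x (A ∸ y)
      ≡⟨ ℚ.*-zeroˡ (alternatingSum x (A ∸ y)) ⟩
    0ℚ
      ≡⟨ *δ-≢ (ℕ→ℚ (x ! ℕ.* y !)) A≢y ⟨
    ℕ→ℚ (x ! ℕ.* y !) * δ A y ∎
    where open ≡-Reasoning
  ... | tri≈ _ refl _ = begin
    ℕ→ℚ (x ! ℕ.* falling A A) * alternatingSum x (A ∸ A)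
      ≡⟨ cong₂ (λ m n → ℕ→ℚ (x ! ℕ.* m) * alternatingSum x n) falling-A-A (ℕ.n∸n≡0 A) ⟩
    ℕ→ℚ (x ! ℕ.* A !) * alternatingSum x 0
      ≡⟨ cong (ℕ→ℚ (x ! ℕ.* A !) *_) (trans (alternatingSum-0 x) (sym (δ-refl A))) ⟩
    ℕ→ℚ (x ! ℕ.* A !) * δ A A ∎
    where
    open ≡-Reasoning
    falling-A-A : falling A A ≡ A !
    falling-A-A = trans (sym (ℕ.*-identityʳ _))
                        (trans (cong (λ m → falling A A ℕ.* m !) (sym (ℕ.n∸n≡0 A))) (falling*[n∸f]!≡n! A A ℕ.≤-refl))
  ... | tri> _ A≢y y<A = begin
    ℕ→ℚ (x ! ℕ.* falling A y) * alternatingSum x (A ∸ y)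
      ≡⟨ cong (ℕ→ℚ (x ! ℕ.* falling A y) *_) (trans (alternatingSum≡δ x (A ∸ y) A∸y≤x) (δ-≢ (ℕ.m>n⇒m∸n≢0 y<A))) ⟩
    ℕ→ℚ (x ! ℕ.* falling A y) * 0ℚ
      ≡⟨ ℚ.*-zeroʳ (ℕ→ℚ (x ! ℕ.* falling A y)) ⟩
    0ℚ
      ≡⟨ *δ-≢ (ℕ→ℚ (x ! ℕ.* y !)) A≢y ⟨
    ℕ→ℚ (x ! ℕ.* y !) * δ A y ∎
    where
    open ≡-Reasoning
    A∸y≤x : A ∸ y ≤ x
    A∸y≤x = subst (A ∸ y ≤_) (ℕ.m+n∸n≡m x y) (ℕ.∸-monoˡ-≤ y A≤x+y)

  signedSum : ℕ → ℕ → ℕ → ℚ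
  signedSum x D A = ∑ (consecutive 0 (suc D)) (λ e → ℕ→ℚ (x C e) * sgn (x ∸ e) * πcoef e (D ∸ e) (suc A))

  -- For e ≤ x the summand is x!·(A)_y·(-1)^(x-e)·C(A-y,x-e); for e > x it vanishes.
  signedSum≡δ : ∀ x y A → A ≤ x ℕ.+ y → signedSum x (x ℕ.+ y) A ≡ ℕ→ℚ (x ! ℕ.* y !) * δ A y
  signedSum≡δ x y A A≤x+y = begin
    ∑ (consecutive 0 (suc x ℕ.+ y)) t
      ≡⟨ cong (λ es → ∑ es t) (consecutive-+ 0 (suc x) y) ⟩
    ∑ (consecutive 0 (suc x) ++ consecutive (suc x) y) t
      ≡⟨ ∑-++ (consecutive 0 (suc x)) (consecutive (suc x) y) t ⟩
    ∑ (consecutive 0 (suc x)) t + ∑ (consecutive (suc x) y) t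
      ≡⟨ cong₂ _+_ (∑-cong-consecutive 0 (suc x) (λ e _ e<1+x → low-terms e (ℕ.≤-pred e<1+x)))
                   (trans (∑-cong-consecutive (suc x) y (λ e x<e _ → high-terms e x<e)) (∑-zero (consecutive (suc x) y))) ⟩
    ∑ (consecutive 0 (suc x)) (λ e → c * (sgn (x ∸ e) * ℕ→ℚ ((A ∸ y) C (x ∸ e)))) + 0ℚ
      ≡⟨ ℚ.+-identityʳ _ ⟩
    ∑ (consecutive 0 (suc x)) (λ e → c * (sgn (x ∸ e) * ℕ→ℚ ((A ∸ y) C (x ∸ e))))
      ≡⟨ ∑-distribˡ-* (consecutive 0 (suc x)) c (λ e → sgn (x ∸ e) * ℕ→ℚ ((A ∸ y) C (x ∸ e))) ⟩
    c * alternatingSum x (A ∸ y)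
      ≡⟨ falling*alternatingSum x y A A≤x+y ⟩
    ℕ→ℚ (x ! ℕ.* y !) * δ A y ∎
    where
    open ≡-Reasoning
    c = ℕ→ℚ (x ! ℕ.* falling A y)
    t : ℕ → ℚ
    t e = ℕ→ℚ (x C e) * sgn (x ∸ e) * πcoef e (x ℕ.+ y ∸ e) (suc A)
    high-terms : ∀ e → x < e → t e ≡ 0ℚ
    high-terms e x<e = begin
      ℕ→ℚ (x C e) * sgn (x ∸ e) * π
        ≡⟨ cong (λ m → ℕ→ℚ m * sgn (x ∸ e) * π) (k>n⇒nCk≡0 x<e) ⟩
      0ℚ * sgn (x ∸ e) * π
        ≡⟨ trans (cong (_* π) (ℚ.*-zeroˡ (sgn (x ∸ e)))) (ℚ.*-zeroˡ π) ⟩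
      0ℚ ∎
      where π = πcoef e (x ℕ.+ y ∸ e) (suc A)
    low-terms : ∀ e → e ≤ x → t e ≡ c * (sgn (x ∸ e) * ℕ→ℚ ((A ∸ y) C (x ∸ e)))
    low-terms e e≤x = begin
      ℕ→ℚ (x C e) * sgn (x ∸ e) * πcoef e (x ℕ.+ y ∸ e) (suc A)
        ≡⟨ cong (ℕ→ℚ (x C e) * sgn (x ∸ e) *_) (πcoef-falling e (x ℕ.+ y ∸ e) A) ⟩
      ℕ→ℚ (x C e) * sgn (x ∸ e) * ℕ→ℚ (e ! ℕ.* falling A (x ℕ.+ y ∸ e))
        ≡⟨ solve 3 (λ a s b → a :* s :* b := s :* (a :* b)) refl (ℕ→ℚ (x C e)) (sgn (x ∸ e)) (ℕ→ℚ (e ! ℕ.* falling A (x ℕ.+ y ∸ e))) ⟩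
      sgn (x ∸ e) * (ℕ→ℚ (x C e) * ℕ→ℚ (e ! ℕ.* falling A (x ℕ.+ y ∸ e)))
        ≡⟨ cong (sgn (x ∸ e) *_) (trans (sym (ℕ→ℚ-* (x C e) _)) (cong ℕ→ℚ (C*!*falling x e y A e≤x))) ⟩
      sgn (x ∸ e) * ℕ→ℚ (x ! ℕ.* falling A y ℕ.* ((A ∸ y) C (x ∸ e)))
        ≡⟨ cong (sgn (x ∸ e) *_) (ℕ→ℚ-* (x ! ℕ.* falling A y) ((A ∸ y) C (x ∸ e))) ⟩
      sgn (x ∸ e) * (c * ℕ→ℚ ((A ∸ y) C (x ∸ e)))
        ≡⟨ solve 3 (λ s a b → s :* (a :* b) := a :* (s :* b)) refl (sgn (x ∸ e)) c (ℕ→ℚ ((A ∸ y) C (x ∸ e))) ⟩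
      c * (sgn (x ∸ e) * ℕ→ℚ ((A ∸ y) C (x ∸ e))) ∎

  -- Relations with k₁ = k₂ = 1

  -- With D = d₁ + d₂, πRelE-diagCoeff d₁ d₂ a and relD-diagCoeff d₁ d₂ a are the coefficients of Z_{a,D+2-a}
  -- in π(relE 1 1 d₁ d₂) and in relD (d₁+1) (d₂+1).
  shuffleSum : ℕ → ℕ → ℕ → ℚ
  shuffleSum d₁ d₂ a = ∑ (consecutive 0 (suc (d₁ ℕ.+ d₂))) (λ e → shuffleCoeff 1 1 d₁ d₂ 1 e * πcoef e (d₁ ℕ.+ d₂ ∸ e) a)

  πRelE-diagCoeff : ℕ → ℕ → ℕ → ℚ
  πRelE-diagCoeff d₁ d₂ a = πcoef d₁ d₂ a + πcoef d₂ d₁ a + shuffleSum d₁ d₂ a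

  relD-diagCoeff : ℕ → ℕ → ℕ → ℚ
  relD-diagCoeff d₁ d₂ a = δ a (suc d₁) + (δ a (suc d₂) + - ℕ→ℚ (shuffleBinomial (suc d₁) (suc d₂) a))

  shuffleSum≡-signedSums : ∀ d₁ d₂ A →
    shuffleSum d₁ d₂ (suc A) ≡ - (signedSum d₁ (d₁ ℕ.+ d₂) A + signedSum d₂ (d₁ ℕ.+ d₂) A)
  shuffleSum≡-signedSums d₁ d₂ A = begin
    ∑ es (λ e → shuffleCoeff 1 1 d₁ d₂ 1 e * πcoef e (D ∸ e) (suc A)) ≡⟨ ∑-cong es split ⟩
    ∑ es (λ e → - (t d₁ e + t d₂ e))                                  ≡⟨ ∑-neg es (λ e → t d₁ e + t d₂ e) ⟩
    - ∑ es (λ e → t d₁ e + t d₂ e)                                    ≡⟨ cong -_ (∑-distrib-+ es (t d₁) (t d₂)) ⟩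
    - (signedSum d₁ D A + signedSum d₂ D A)                           ∎
    where
    open ≡-Reasoning
    D = d₁ ℕ.+ d₂
    es = consecutive 0 (suc D)
    t : ℕ → ℕ → ℚ
    t x e = ℕ→ℚ (x C e) * sgn (x ∸ e) * πcoef e (D ∸ e) (suc A)
    split : ∀ e → shuffleCoeff 1 1 d₁ d₂ 1 e * πcoef e (D ∸ e) (suc A) ≡ - (t d₁ e + t d₂ e)
    split e = trans
      (cong₂ (λ a b → - (ℕ→ℚ a * sgn (d₁ ∸ e) + ℕ→ℚ b * sgn (d₂ ∸ e)) * πcoef e (D ∸ e) (suc A))
             (ℕ.*-identityˡ (d₁ C e)) (ℕ.*-identityˡ (d₂ C e)))
      (solve 5 (λ a s b u p → (:- (a :* s :+ b :* u)) :* p := :- (a :* s :* p :+ b :* u :* p)) refl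
         (ℕ→ℚ (d₁ C e)) (sgn (d₁ ∸ e)) (ℕ→ℚ (d₂ C e)) (sgn (d₂ ∸ e)) (πcoef e (D ∸ e) (suc A)))

  πRelE-diagCoeff≡ : ∀ d₁ d₂ A → A ≤ d₁ ℕ.+ d₂ →
    πRelE-diagCoeff d₁ d₂ (suc A) ≡ - ℕ→ℚ (d₁ ! ℕ.* d₂ !) * relD-diagCoeff d₁ d₂ (suc A)
  πRelE-diagCoeff≡ d₁ d₂ A A≤D = begin
    πcoef d₁ d₂ (suc A) + πcoef d₂ d₁ (suc A) + shuffleSum d₁ d₂ (suc A)
      ≡⟨ cong (_+_ (πcoef d₁ d₂ (suc A) + πcoef d₂ d₁ (suc A))) (shuffleSum≡-signedSums d₁ d₂ A) ⟩
    πcoef d₁ d₂ (suc A) + πcoef d₂ d₁ (suc A) + - (signedSum d₁ D A + signedSum d₂ D A)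
      ≡⟨ cong₂ _+_ (cong₂ _+_ (πcoef-binomial d₁ d₂ A) πcoef₂) (cong -_ (cong₂ _+_ (signedSum≡δ d₁ d₂ A A≤D) signedSum₂)) ⟩
    c * ℕ→ℚ (A C d₂) + c * ℕ→ℚ (A C d₁) + - (c * δ A d₂ + c * δ A d₁)
      ≡⟨ solve 5 (λ c b₂ b₁ δ₂ δ₁ → c :* b₂ :+ c :* b₁ :+ :- (c :* δ₂ :+ c :* δ₁)
                                  := (:- c) :* (δ₁ :+ (δ₂ :+ :- (b₁ :+ b₂))))
           refl c (ℕ→ℚ (A C d₂)) (ℕ→ℚ (A C d₁)) (δ A d₂) (δ A d₁) ⟩
    - c * (δ A d₁ + (δ A d₂ + - (ℕ→ℚ (A C d₁) + ℕ→ℚ (A C d₂))))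
      ≡⟨ cong (λ b → - c * (δ A d₁ + (δ A d₂ + - b))) (ℕ→ℚ-+ (A C d₁) (A C d₂)) ⟨
    - c * relD-diagCoeff d₁ d₂ (suc A) ∎
    where
    open ≡-Reasoning
    D = d₁ ℕ.+ d₂
    c = ℕ→ℚ (d₁ ! ℕ.* d₂ !)
    d₂!d₁!≡d₁!d₂! : ℕ→ℚ (d₂ ! ℕ.* d₁ !) ≡ c
    d₂!d₁!≡d₁!d₂! = cong ℕ→ℚ (ℕ.*-comm (d₂ !) (d₁ !))
    πcoef₂ : πcoef d₂ d₁ (suc A) ≡ c * ℕ→ℚ (A C d₁)
    πcoef₂ = trans (πcoef-binomial d₂ d₁ A) (cong (_* ℕ→ℚ (A C d₁)) d₂!d₁!≡d₁!d₂!)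
    signedSum₂ : signedSum d₂ D A ≡ c * δ A d₁
    signedSum₂ = begin
      signedSum d₂ D A                    ≡⟨ cong (λ n → signedSum d₂ n A) (ℕ.+-comm d₁ d₂) ⟩
      signedSum d₂ (d₂ ℕ.+ d₁) A          ≡⟨ signedSum≡δ d₂ d₁ A (subst (A ≤_) (ℕ.+-comm d₁ d₂) A≤D) ⟩
      ℕ→ℚ (d₂ ! ℕ.* d₁ !) * δ A d₁        ≡⟨ cong (_* δ A d₁) d₂!d₁!≡d₁!d₂! ⟩
      c * δ A d₁                          ∎

  πG-G₂-exceptional : ∀ x y s → 1 ≤ x ℕ.+ y →
    coeffZ (πG (G₂ 1 1 x y)) s ≡ ∑ (consecutive 1 (suc (x ℕ.+ y))) (λ a → πcoef x y a * diagIndicator (x ℕ.+ y) s a)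
  πG-G₂-exceptional x y s 1≤x+y = begin
    coeffZ (πG (G₂ 1 1 x y)) s                   ≡⟨ coeffZ-πG-G₂ 1 1 x y s ⟩
    δ x 0 * δ y 0 * indicator (Z₂ 1 1) s + 1ℚ * Σa ≡⟨ cong₂ _+_ (trans (cong (_* indicator (Z₂ 1 1) s) (δ₀-product-vanishes {x} {y} 1≤x+y))
                                                                    (ℚ.*-zeroˡ (indicator (Z₂ 1 1) s)))
                                                             (ℚ.*-identityˡ Σa) ⟩
    0ℚ + Σa                                      ≡⟨ ℚ.+-identityˡ Σa ⟩
    Σa                                           ∎
    where
    open ≡-Reasoning
    Σa = ∑ (consecutive 1 (suc (x ℕ.+ y))) (λ a → πcoef x y a * diagIndicator (x ℕ.+ y) s a)

  ∑-shuffles-exceptional : ∀ d₁ d₂ s → 1 ≤ d₁ ℕ.+ d₂ → let D = d₁ ℕ.+ d₂ in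
    ∑ (range 0 D) (λ e → shuffleCoeff 1 1 d₁ d₂ 1 e * coeffZ (πG (G₂ 1 1 e (D ∸ e))) s)
      ≡ ∑ (consecutive 1 (suc D)) (λ a → shuffleSum d₁ d₂ a * diagIndicator D s a)
  ∑-shuffles-exceptional d₁ d₂ s 1≤D = begin
    ∑ (range 0 D) (λ e → sc e * coeffZ (πG (G₂ 1 1 e (D ∸ e))) s)
      ≡⟨ cong (λ es → ∑ es (λ e → sc e * coeffZ (πG (G₂ 1 1 e (D ∸ e))) s)) (range≡consecutive 0 D) ⟩
    ∑ es (λ e → sc e * coeffZ (πG (G₂ 1 1 e (D ∸ e))) s)
      ≡⟨ ∑-cong-consecutive 0 (suc D) (λ e _ e<1+D → cong (sc e *_) (expand e (ℕ.≤-pred e<1+D))) ⟩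
    ∑ es (λ e → sc e * ∑ as (λ a → πcoef e (D ∸ e) a * diagIndicator D s a))
      ≡⟨ ∑-cong es (λ e → sym (∑-distribˡ-* as (sc e) (λ a → πcoef e (D ∸ e) a * diagIndicator D s a))) ⟩
    ∑ es (λ e → ∑ as (λ a → sc e * (πcoef e (D ∸ e) a * diagIndicator D s a)))
      ≡⟨ ∑-comm es as (λ e a → sc e * (πcoef e (D ∸ e) a * diagIndicator D s a)) ⟩
    ∑ as (λ a → ∑ es (λ e → sc e * (πcoef e (D ∸ e) a * diagIndicator D s a)))
      ≡⟨ ∑-cong as (λ a → trans (∑-cong es (λ e → sym (ℚ.*-assoc (sc e) (πcoef e (D ∸ e) a) (diagIndicator D s a))))
                                (∑-distribʳ-* es (diagIndicator D s a) (λ e → sc e * πcoef e (D ∸ e) a))) ⟩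
    ∑ as (λ a → shuffleSum d₁ d₂ a * diagIndicator D s a) ∎
    where
    open ≡-Reasoning
    D = d₁ ℕ.+ d₂
    es = consecutive 0 (suc D)
    as = consecutive 1 (suc D)
    sc = shuffleCoeff 1 1 d₁ d₂ 1
    expand : ∀ e → e ≤ D → coeffZ (πG (G₂ 1 1 e (D ∸ e))) s ≡ ∑ as (λ a → πcoef e (D ∸ e) a * diagIndicator D s a)
    expand e e≤D = trans (πG-G₂-exceptional e (D ∸ e) s (subst (1 ≤_) (sym e+[D∸e]≡D) 1≤D))
                         (cong (λ n → ∑ (consecutive 1 (suc n)) (λ a → πcoef e (D ∸ e) a * diagIndicator n s a)) e+[D∸e]≡D)
      where
      e+[D∸e]≡D : e ℕ.+ (D ∸ e) ≡ D
      e+[D∸e]≡D = ℕ.m+[n∸m]≡n e≤D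

  correction-exceptional : ∀ d₁ d₂ s → let D = d₁ ℕ.+ d₂ in
    correctionCoeff 1 1 d₁ d₂ * coeffZ (πG (G₁ 1 (suc D))) s ≡ - ℕ→ℚ (d₁ ! ℕ.* d₂ !) * indicator (Z₁ (suc (suc D))) s
  correction-exceptional d₁ d₂ s = begin
    correctionCoeff 1 1 d₁ d₂ * coeffZ (πG (G₁ 1 (suc D))) s
      ≡⟨ cong (correctionCoeff 1 1 d₁ d₂ *_) (coeffZ-πG-G₁ 1 (suc D) s) ⟩
    - (q * 1ℚ) * (0ℚ * indicator (Z₁ 1) s + 1ℚ * ℕ→ℚ (suc D !) * ind)
      ≡⟨ cong₂ (λ a b → - a * (b + 1ℚ * ℕ→ℚ (suc D !) * ind)) (ℚ.*-identityʳ q) (ℚ.*-zeroˡ (indicator (Z₁ 1) s)) ⟩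
    - q * (0ℚ + 1ℚ * ℕ→ℚ (suc D !) * ind)
      ≡⟨ solve 3 (λ q n i → (:- q) :* (con 0ℚ :+ con 1ℚ :* n :* i) := :- (q :* n) :* i) refl q (ℕ→ℚ (suc D !)) ind ⟩
    - (q * ℕ→ℚ (suc D !)) * ind
      ≡⟨ cong (λ a → - a * ind) ([m/n]*n≡m (d₁ ! ℕ.* d₂ !) (suc D !) {{ℕ._!≢0 (suc D)}}) ⟩
    - ℕ→ℚ (d₁ ! ℕ.* d₂ !) * ind ∎
    where
    open ≡-Reasoning
    D = d₁ ℕ.+ d₂
    q = ((+ (d₁ ! ℕ.* d₂ !)) / (suc D !)) {{ℕ._!≢0 (suc D)}}
    ind = indicator (Z₁ (suc (suc D))) s

  coeffZ-π-relE-exceptional : ∀ d₁ d₂ s → 1 ≤ d₁ ℕ.+ d₂ → let D = d₁ ℕ.+ d₂ in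
    coeffZ (πLin (relE 1 1 d₁ d₂)) s ≡
      ∑ (consecutive 1 (suc D)) (λ a → πRelE-diagCoeff d₁ d₂ a * diagIndicator D s a)
        + - ℕ→ℚ (d₁ ! ℕ.* d₂ !) * indicator (Z₁ (suc (suc D))) s
  coeffZ-π-relE-exceptional d₁ d₂ s 1≤D = begin
    coeffZ (πLin (relE 1 1 d₁ d₂)) s
      ≡⟨ coeffZ-πLin (relE 1 1 d₁ d₂) s ⟩
    ∑ (relE 1 1 d₁ d₂) (weigh f)
      ≡⟨ ∑-relE f 1 1 d₁ d₂ ⟩
    f (G₂ 1 1 d₁ d₂) + (f (G₂ 1 1 d₂ d₁) + (f (G₁ 2 D) +
      ((∑ (range 0 D) (λ e → shuffleCoeff 1 1 d₁ d₂ 1 e * f (G₂ 1 1 e (D ∸ e))) + 0ℚ)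
       + correctionCoeff 1 1 d₁ d₂ * f (G₁ 1 (suc D)))))
      ≡⟨ cong₂ _+_ (πG-G₂-exceptional d₁ d₂ s 1≤D)
         (cong₂ _+_ (trans (πG-G₂-exceptional d₂ d₁ s (subst (1 ≤_) (ℕ.+-comm d₁ d₂) 1≤D))
                           (cong (λ n → ∑ (consecutive 1 (suc n)) (λ a → p₂ a * diagIndicator n s a)) (ℕ.+-comm d₂ d₁)))
         (cong₂ _+_ (πG-G₁-vanishes 2 D s ℕ.≤-refl 1≤D)
         (cong₂ _+_ (cong (_+ 0ℚ) (∑-shuffles-exceptional d₁ d₂ s 1≤D)) (correction-exceptional d₁ d₂ s)))) ⟩
    T₁ + (T₂ + (0ℚ + ((T₃ + 0ℚ) + - c * ind)))
      ≡⟨ solve 4 (λ x y z w → x :+ (y :+ (con 0ℚ :+ ((z :+ con 0ℚ) :+ w))) := x :+ y :+ z :+ w) refl T₁ T₂ T₃ (- c * ind) ⟩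
    T₁ + T₂ + T₃ + - c * ind
      ≡⟨ cong (_+ - c * ind) merge ⟩
    ∑ as (λ a → πRelE-diagCoeff d₁ d₂ a * diagIndicator D s a) + - c * ind ∎
    where
    open ≡-Reasoning
    D = d₁ ℕ.+ d₂
    as = consecutive 1 (suc D)
    f = λ g → coeffZ (πG g) s
    c = ℕ→ℚ (d₁ ! ℕ.* d₂ !)
    ind = indicator (Z₁ (suc (suc D))) s
    p₁ p₂ : ℕ → ℚ
    p₁ = πcoef d₁ d₂
    p₂ = πcoef d₂ d₁
    T₁ = ∑ as (λ a → p₁ a * diagIndicator D s a)
    T₂ = ∑ as (λ a → p₂ a * diagIndicator D s a)
    T₃ = ∑ as (λ a → shuffleSum d₁ d₂ a * diagIndicator D s a)
    merge : T₁ + T₂ + T₃ ≡ ∑ as (λ a → πRelE-diagCoeff d₁ d₂ a * diagIndicator D s a)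
    merge = begin
      T₁ + T₂ + T₃
        ≡⟨ cong (_+ T₃) (∑-distrib-+ as (λ a → p₁ a * diagIndicator D s a) (λ a → p₂ a * diagIndicator D s a)) ⟨
      ∑ as (λ a → p₁ a * diagIndicator D s a + p₂ a * diagIndicator D s a) + T₃
        ≡⟨ ∑-distrib-+ as (λ a → p₁ a * diagIndicator D s a + p₂ a * diagIndicator D s a)
                          (λ a → shuffleSum d₁ d₂ a * diagIndicator D s a) ⟨
      ∑ as (λ a → p₁ a * diagIndicator D s a + p₂ a * diagIndicator D s a + shuffleSum d₁ d₂ a * diagIndicator D s a)
        ≡⟨ ∑-cong as (λ a → solve 4 (λ x y z i → x :* i :+ y :* i :+ z :* i := (x :+ y :+ z) :* i) refl
                                     (p₁ a) (p₂ a) (shuffleSum d₁ d₂ a) (diagIndicator D s a)) ⟩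
      ∑ as (λ a → πRelE-diagCoeff d₁ d₂ a * diagIndicator D s a) ∎

  indicator≡∑δ : ∀ x y s →
    indicator (Z₂ (suc x) (suc y)) s ≡ ∑ (consecutive 1 (suc (x ℕ.+ y))) (λ j → δ j (suc x) * diagIndicator (x ℕ.+ y) s j)
  indicator≡∑δ x y s = sym (trans
    (∑-δ 1 (suc (x ℕ.+ y)) (suc x) (diagIndicator (x ℕ.+ y) s) (s≤s z≤n) (s≤s (s≤s (ℕ.m≤m+n x y))))
    (cong (λ n → indicator (Z₂ (suc x) n) s) (trans (cong (_∸ x) (sym (ℕ.+-suc x y))) (ℕ.m+n∸m≡n x (suc y)))))

  coeffZ-relD-diagonal : ∀ d₁ d₂ s → let D = d₁ ℕ.+ d₂ in
    coeffZ (relD (suc d₁) (suc d₂)) s ≡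
      ∑ (consecutive 1 (suc D)) (λ a → relD-diagCoeff d₁ d₂ a * diagIndicator D s a) + indicator (Z₁ (suc (suc D))) s
  coeffZ-relD-diagonal d₁ d₂ s = begin
    coeffZ (relD (suc d₁) (suc d₂)) s
      ≡⟨ coeffZ-relD (suc d₁) (suc d₂) s ⟩
    indicator (Z₂ (suc d₁) (suc d₂)) s + (indicator (Z₂ (suc d₂) (suc d₁)) s + tail (suc d₁ ℕ.+ suc d₂))
      ≡⟨ cong₂ _+_ (indicator≡∑δ d₁ d₂ s)
           (cong₂ _+_ (trans (indicator≡∑δ d₂ d₁ s)
                             (cong (λ n → ∑ (consecutive 1 (suc n)) (λ j → δ j (suc d₂) * diagIndicator n s j)) (ℕ.+-comm d₂ d₁)))
                      (trans (cong tail (cong suc (ℕ.+-suc d₁ d₂)))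
                             (cong (λ js → ind + ∑ js (λ a → b a * diagIndicator D s a)) (range≡consecutive 1 (suc D))))) ⟩
    ∑ as (λ a → δ a (suc d₁) * diagIndicator D s a)
      + (∑ as (λ a → δ a (suc d₂) * diagIndicator D s a) + (ind + ∑ as (λ a → b a * diagIndicator D s a)))
      ≡⟨ solve 4 (λ x y i z → x :+ (y :+ (i :+ z)) := x :+ (y :+ z) :+ i) refl
           (∑ as (λ a → δ a (suc d₁) * diagIndicator D s a)) (∑ as (λ a → δ a (suc d₂) * diagIndicator D s a))
           ind (∑ as (λ a → b a * diagIndicator D s a)) ⟩
    (∑ as (λ a → δ a (suc d₁) * diagIndicator D s a)
      + (∑ as (λ a → δ a (suc d₂) * diagIndicator D s a) + ∑ as (λ a → b a * diagIndicator D s a))) + ind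
      ≡⟨ cong (_+ ind) merge ⟩
    ∑ as (λ a → relD-diagCoeff d₁ d₂ a * diagIndicator D s a) + ind ∎
    where
    open ≡-Reasoning
    D = d₁ ℕ.+ d₂
    as = consecutive 1 (suc D)
    ind = indicator (Z₁ (suc (suc D))) s
    b : ℕ → ℚ
    b j = - ℕ→ℚ (shuffleBinomial (suc d₁) (suc d₂) j)
    tail : ℕ → ℚ
    tail k = indicator (Z₁ k) s + ∑ (range 1 (k ∸ 1)) (λ j → b j * indicator (Z₂ j (k ∸ j)) s)
    merge : ∑ as (λ a → δ a (suc d₁) * diagIndicator D s a)
              + (∑ as (λ a → δ a (suc d₂) * diagIndicator D s a) + ∑ as (λ a → b a * diagIndicator D s a))
            ≡ ∑ as (λ a → relD-diagCoeff d₁ d₂ a * diagIndicator D s a)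
    merge = begin
      ∑ as (λ a → δ a (suc d₁) * diagIndicator D s a)
        + (∑ as (λ a → δ a (suc d₂) * diagIndicator D s a) + ∑ as (λ a → b a * diagIndicator D s a))
        ≡⟨ cong (_+_ (∑ as (λ a → δ a (suc d₁) * diagIndicator D s a)))
                (∑-distrib-+ as (λ a → δ a (suc d₂) * diagIndicator D s a) (λ a → b a * diagIndicator D s a)) ⟨
      ∑ as (λ a → δ a (suc d₁) * diagIndicator D s a)
        + ∑ as (λ a → δ a (suc d₂) * diagIndicator D s a + b a * diagIndicator D s a)
        ≡⟨ ∑-distrib-+ as (λ a → δ a (suc d₁) * diagIndicator D s a)
                          (λ a → δ a (suc d₂) * diagIndicator D s a + b a * diagIndicator D s a) ⟨
      ∑ as (λ a → δ a (suc d₁) * diagIndicator D s a + (δ a (suc d₂) * diagIndicator D s a + b a * diagIndicator D s a))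
        ≡⟨ ∑-cong as (λ a → solve 4 (λ x y z i → x :* i :+ (y :* i :+ z :* i) := (x :+ (y :+ z)) :* i) refl
                                     (δ a (suc d₁)) (δ a (suc d₂)) (b a) (diagIndicator D s a)) ⟩
      ∑ as (λ a → relD-diagCoeff d₁ d₂ a * diagIndicator D s a) ∎

  π-relE-exceptional : ∀ d₁ d₂ → 1 ≤ d₁ ℕ.+ d₂ → ∀ s →
    coeffZ (πLin (relE 1 1 d₁ d₂)) s ≡ - ℕ→ℚ (d₁ ! ℕ.* d₂ !) * coeffZ (relD (suc d₁) (suc d₂)) s
  π-relE-exceptional d₁ d₂ 1≤D s = begin
    coeffZ (πLin (relE 1 1 d₁ d₂)) s
      ≡⟨ coeffZ-π-relE-exceptional d₁ d₂ s 1≤D ⟩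
    ∑ as (λ a → πRelE-diagCoeff d₁ d₂ a * diagIndicator D s a) + - c * ind
      ≡⟨ cong (_+ - c * ind) (∑-cong-consecutive 1 (suc D) diagonal) ⟩
    ∑ as (λ a → - c * (relD-diagCoeff d₁ d₂ a * diagIndicator D s a)) + - c * ind
      ≡⟨ cong (_+ - c * ind) (∑-distribˡ-* as (- c) (λ a → relD-diagCoeff d₁ d₂ a * diagIndicator D s a)) ⟩
    - c * ∑ as (λ a → relD-diagCoeff d₁ d₂ a * diagIndicator D s a) + - c * ind
      ≡⟨ ℚ.*-distribˡ-+ (- c) _ ind ⟨
    - c * (∑ as (λ a → relD-diagCoeff d₁ d₂ a * diagIndicator D s a) + ind)
      ≡⟨ cong (- c *_) (coeffZ-relD-diagonal d₁ d₂ s) ⟨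
    - c * coeffZ (relD (suc d₁) (suc d₂)) s ∎
    where
    open ≡-Reasoning
    D = d₁ ℕ.+ d₂
    as = consecutive 1 (suc D)
    c = ℕ→ℚ (d₁ ! ℕ.* d₂ !)
    ind = indicator (Z₁ (suc (suc D))) s
    diagonal : ∀ a → 1 ≤ a → a < 1 ℕ.+ suc D →
      πRelE-diagCoeff d₁ d₂ a * diagIndicator D s a ≡ - c * (relD-diagCoeff d₁ d₂ a * diagIndicator D s a)
    diagonal (suc A) _ (s≤s A<1+D) = trans (cong (_* diagIndicator D s (suc A)) (πRelE-diagCoeff≡ d₁ d₂ A (ℕ.≤-pred A<1+D)))
                                           (ℚ.*-assoc (- c) (relD-diagCoeff d₁ d₂ (suc A)) (diagIndicator D s (suc A)))

  coeffZ-relSpan : ∀ K (c : ℕ → ℚ) s →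
    coeffZ (sumL (range 1 (K ∸ 1)) (λ j → scale (c j) (relD j (K ∸ j)))) s
      ≡ ∑ (consecutive 1 (K ∸ 1)) (λ j → c j * coeffZ (relD j (K ∸ j)) s)
  coeffZ-relSpan K c s = trans (coeffZ-sumL (range 1 (K ∸ 1)) (λ j → scale (c j) (relD j (K ∸ j))) s)
    (trans (cong (λ js → ∑ js (λ j → coeffZ (scale (c j) (relD j (K ∸ j))) s)) (range≡consecutive 1 (K ∸ 1)))
           (∑-cong (consecutive 1 (K ∸ 1)) (λ j → coeffZ-scale (c j) (relD j (K ∸ j)) s)))

  inRelSpan-zero : ∀ K v → (∀ s → coeffZ v s ≡ 0ℚ) → InRelSpanD K v
  inRelSpan-zero K v v≈0 = (λ _ → 0ℚ) , λ s → trans (v≈0 s) (sym (trans (coeffZ-relSpan K (λ _ → 0ℚ) s)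
    (∑-vanishes (consecutive 1 (K ∸ 1)) _ (λ j → ℚ.*-zeroˡ (coeffZ (relD j (K ∸ j)) s)))))

  inRelSpan-relD : ∀ K v J J' α → 1 ≤ J → J < K → K ∸ J ≡ J' →
    (∀ s → coeffZ v s ≡ α * coeffZ (relD J J') s) → InRelSpanD K v
  inRelSpan-relD K v J J' α 1≤J J<K K∸J≡J' v≈αrelD = (λ j → δ j J * α) , λ s → trans (v≈αrelD s) (sym (begin
    coeffZ (sumL (range 1 (K ∸ 1)) (λ j → scale (δ j J * α) (relD j (K ∸ j)))) s
      ≡⟨ coeffZ-relSpan K (λ j → δ j J * α) s ⟩
    ∑ (consecutive 1 (K ∸ 1)) (λ j → δ j J * α * coeffZ (relD j (K ∸ j)) s)
      ≡⟨ ∑-cong (consecutive 1 (K ∸ 1)) (λ j → ℚ.*-assoc (δ j J) α _) ⟩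
    ∑ (consecutive 1 (K ∸ 1)) (λ j → δ j J * (α * coeffZ (relD j (K ∸ j)) s))
      ≡⟨ ∑-δ 1 (K ∸ 1) J (λ j → α * coeffZ (relD j (K ∸ j)) s) 1≤J
             (subst (J <_) (sym (ℕ.m+[n∸m]≡n (ℕ.≤-trans 1≤J (ℕ.<⇒≤ J<K)))) J<K) ⟩
    α * coeffZ (relD J (K ∸ J)) s
      ≡⟨ cong (λ n → α * coeffZ (relD J n) s) K∸J≡J' ⟩
    α * coeffZ (relD J J') s ∎))
    where open ≡-Reasoning

  -- π(relE 1 1 0 0) = 2 Z₁,₁ + Z₂ - 2 Z₁,₁ - Z₂.
  π-relE-1100-vanishes : ∀ s → coeffZ (πLin (relE 1 1 0 0)) s ≡ 0ℚ
  π-relE-1100-vanishes (Z₁ zero)                       = refl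
  π-relE-1100-vanishes (Z₁ (suc zero))                 = refl
  π-relE-1100-vanishes (Z₁ (suc (suc zero)))           = refl
  π-relE-1100-vanishes (Z₁ (suc (suc (suc n))))        = refl
  π-relE-1100-vanishes (Z₂ zero b)                     = refl
  π-relE-1100-vanishes (Z₂ (suc zero) zero)            = refl
  π-relE-1100-vanishes (Z₂ (suc zero) (suc zero))      = refl
  π-relE-1100-vanishes (Z₂ (suc zero) (suc (suc b)))   = refl
  π-relE-1100-vanishes (Z₂ (suc (suc a)) b)            = refl

  1+x+y∸1+x≡1+y : ∀ x y → suc (suc (x ℕ.+ y)) ∸ suc x ≡ suc y
  1+x+y∸1+x≡1+y x y = trans (cong (_∸ x) (sym (ℕ.+-suc x y))) (ℕ.m+n∸m≡n x (suc y))

  π-relE-inRelSpan-exceptional⁺ : ∀ d₁ d₂ → 1 ≤ d₁ ℕ.+ d₂ → InRelSpanD (2 ℕ.+ d₁ ℕ.+ d₂) (πLin (relE 1 1 d₁ d₂))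
  π-relE-inRelSpan-exceptional⁺ d₁ d₂ 1≤D =
    inRelSpan-relD (2 ℕ.+ d₁ ℕ.+ d₂) (πLin (relE 1 1 d₁ d₂)) (suc d₁) (suc d₂) (- ℕ→ℚ (d₁ ! ℕ.* d₂ !))
                   (s≤s z≤n) (s≤s (s≤s (ℕ.m≤m+n d₁ d₂)))
                   (1+x+y∸1+x≡1+y d₁ d₂) (π-relE-exceptional d₁ d₂ 1≤D)

  π-relE-inRelSpan-exceptional : ∀ d₁ d₂ → InRelSpanD (2 ℕ.+ d₁ ℕ.+ d₂) (πLin (relE 1 1 d₁ d₂))
  π-relE-inRelSpan-exceptional zero     zero     = inRelSpan-zero 2 (πLin (relE 1 1 0 0)) π-relE-1100-vanishes
  π-relE-inRelSpan-exceptional zero     (suc d₂) = π-relE-inRelSpan-exceptional⁺ zero (suc d₂) (s≤s z≤n)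
  π-relE-inRelSpan-exceptional (suc d₁) d₂       = π-relE-inRelSpan-exceptional⁺ (suc d₁) d₂ (s≤s z≤n)

  π-relE-inRelSpan-regular : ∀ k₁ k₂ d₁ d₂ → 1 ≤ k₁ → 1 ≤ k₂ → 3 ≤ k₁ ℕ.+ k₂ →
    InRelSpanD (k₁ ℕ.+ k₂ ℕ.+ d₁ ℕ.+ d₂) (πLin (relE k₁ k₂ d₁ d₂))
  π-relE-inRelSpan-regular k₁ k₂ zero zero 1≤k₁ 1≤k₂ 3≤k =
    inRelSpan-relD (k₁ ℕ.+ k₂ ℕ.+ 0 ℕ.+ 0) (πLin (relE k₁ k₂ 0 0)) k₁ k₂ 1ℚ
                   1≤k₁ (subst (k₁ <_) (sym K≡k₁+k₂) (ℕ.m<m+n k₁ 1≤k₂))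
                   (trans (cong (_∸ k₁) K≡k₁+k₂) (ℕ.m+n∸m≡n k₁ k₂))
                   (λ s → trans (π-relE-regular-depth0 k₁ k₂ 3≤k s) (sym (ℚ.*-identityˡ (coeffZ (relD k₁ k₂) s))))
    where
    K≡k₁+k₂ : k₁ ℕ.+ k₂ ℕ.+ 0 ℕ.+ 0 ≡ k₁ ℕ.+ k₂
    K≡k₁+k₂ = trans (ℕ.+-identityʳ _) (ℕ.+-identityʳ _)
  π-relE-inRelSpan-regular k₁ k₂ zero (suc d₂) _ _ 3≤k =
    inRelSpan-zero (k₁ ℕ.+ k₂ ℕ.+ zero ℕ.+ suc d₂) (πLin (relE k₁ k₂ zero (suc d₂)))
                   (π-relE-regular-vanishes k₁ k₂ zero (suc d₂) 3≤k (s≤s z≤n))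
  π-relE-inRelSpan-regular k₁ k₂ (suc d₁) d₂ _ _ 3≤k =
    inRelSpan-zero (k₁ ℕ.+ k₂ ℕ.+ suc d₁ ℕ.+ d₂) (πLin (relE k₁ k₂ (suc d₁) d₂))
                   (π-relE-regular-vanishes k₁ k₂ (suc d₁) d₂ 3≤k (s≤s z≤n))

open import Data.Nat using (ℕ; suc; _+_; _≤_; z≤n; s≤s)
import Data.Nat.Properties as ℕ
open import Relation.Binary.PropositionalEquality using (_≡_; refl)
open Coefficients using (π-relE-inRelSpan-exceptional; π-relE-inRelSpan-regular)

proposition2p5 : (k : ℕ) → 1 ≤ k →
    (k₁ k₂ d₁ d₂ : ℕ) → 1 ≤ k₁ → 1 ≤ k₂ → k₁ + k₂ + d₁ + d₂ ≡ k →
    InRelSpanD k (πLin (relE k₁ k₂ d₁ d₂))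
proposition2p5 _ _ 1               1              d₁ d₂ _ _ refl = π-relE-inRelSpan-exceptional d₁ d₂
proposition2p5 _ _ 1               (suc (suc k₂)) d₁ d₂ _ _ refl =
  π-relE-inRelSpan-regular 1 (suc (suc k₂)) d₁ d₂ (s≤s z≤n) (s≤s z≤n) (s≤s (s≤s (s≤s z≤n)))
proposition2p5 _ _ (suc (suc k₁)) (suc k₂)       d₁ d₂ _ _ refl =
  π-relE-inRelSpan-regular (suc (suc k₁)) (suc k₂) d₁ d₂ (s≤s z≤n) (s≤s z≤n)
    (s≤s (s≤s (ℕ.≤-trans (s≤s z≤n) (ℕ.m≤n+m (suc k₂) k₁))))
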